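{- Let $k\ge 1$, $d\ge k$, $\nu>d$ be integers and $(Y,X)$ a base of $LP_{\nu,d,k}$. Then $(Y,X)$ is feasible if and only if, when the elements of $Y\cup X$ are listed in decreasing order, they alternately belong to $X$ and $Y$ (the largest belonging to $X$, the next to $Y$, the next to $X$, and so on).
   Context: Binomial coefficients $\binom{n}{m}$ are $0$ when $m<0$ or $m>n$. $LP_{\nu,d,k}$ is the linear program in real variables $y_0,\ldots,y_{\nu-1},x_0,\ldots,x_d\ge 0$: minimize $\sum_{i=0}^{\nu-1}\binom{\nu}{i}y_i+\sum_{i=0}^d\binom{\nu}{i}x_i$ subject to $(c_k)$: $\sum_{i=k}^d\binom{\nu-k}{i-k}x_i-\sum_{i=k}^{\nu-1}\binom{\nu-k}{i-k}y_i=1$, and $(c_h)$ for $h\in\{0,\ldots,k-1\}$: $\sum_{i=h}^d\binom{\nu-k}{i-h}x_i-\sum_{i=h}^{\nu-k+h}\binom{\nu-k}{i-h}y_i=0$. A pair $(Y,X)$ with $Y\subseteq\{0,\ldots,\nu-1\}$, $X\subseteq\{0,\ldots,d\}$ is a base if the variables $\{y_i:i\in Y\}\cup\{x_i:i\in X\}$ form a linear-programming basis (their constraint-matrix columns form a basis of $\mathbb{R}^{k+1}$); its basic solution is the unique solution of the equality constraints with all other variables $0$. The base is feasible if all coordinates of its basic solution are non-negative.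
   Formalization: The variables of $LP_{\nu,d,k}$ take rational rather than real values, so bases are bases of ℚ^(k+1) and basic solutions are rational. -}

module Defs where

open import Data.Nat as ℕ using (ℕ; zero; suc; _≤ᵇ_; _∸_)
open import Data.Nat.Combinatorics using (_C_)
open import Data.Bool using (Bool; true; false; if_then_else_; _∧_)
open import Data.Fin using (Fin; toℕ)
open import Data.Fin.Subset using (Subset; _∉_)
open import Data.Vec using ([]) renaming (_∷_ to _∷ᵛ_)
open import Data.Integer using (+_)
open import Data.Rational using (ℚ; 0ℚ; 1ℚ; _+_; _*_; _-_; _≤_; _/_)
open import Data.List using (List; []; _∷_; _++_)
open import Data.Product using (_×_; Σ)
open import Data.Unit using (⊤)
open import Relation.Binary.PropositionalEquality using (_≡_)

Σ[<_]_ : (n : ℕ) → (Fin n → ℚ) → ℚ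
Σ[< zero ] f = 0ℚ
Σ[< suc n ] f = f Data.Fin.zero + Σ[< n ] (λ i → f (Data.Fin.suc i))

ℕ→ℚ : ℕ → ℚ
ℕ→ℚ n = (+ n) / 1

-- binomial coefficient binom(n, i - h) with the convention that it is 0
-- when i - h < 0 (i.e. i < h) or i - h > n (the latter by the stdlib's _C_)
binomDiff : ℕ → ℕ → ℕ → ℕ
binomDiff n i h = if h ≤ᵇ i then n C (i ∸ h) else 0

-- Coefficient of x_i in constraint (c_h), h ∈ {0..k}:
--   binom(ν-k, i-h)   for h ≤ i ≤ d
xCoef : (ν k h i : ℕ) → ℚ
xCoef ν k h i = ℕ→ℚ (binomDiff (ν ∸ k) i h)

-- Coefficient of y_i in constraint (c_h):
--   (c_k)     : - binom(ν-k, i-k)  for k ≤ i ≤ ν-1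
--   (c_h), h<k: - binom(ν-k, i-h)  for h ≤ i ≤ ν-k+h
yCoef : (ν k h i : ℕ) → ℚ
yCoef ν k h i =
  if (h ≤ᵇ i) ∧ (i ≤ᵇ ((ν ∸ k) ℕ.+ h)) then ℕ→ℚ (binomDiff (ν ∸ k) i h) else 0ℚ

lhs : (ν d k : ℕ) → (h : ℕ) → (Fin ν → ℚ) → (Fin (suc d) → ℚ) → ℚ
lhs ν d k h y x =
  Σ[< suc d ] (λ i → xCoef ν k h (toℕ i) * x i)
  - Σ[< ν ] (λ i → yCoef ν k h (toℕ i) * y i)

rhs : (k h : ℕ) → ℚ
rhs k h = if (k ≤ᵇ h) then 1ℚ else 0ℚ

SupportedOn : {ν d : ℕ} → Subset ν → Subset (suc d)
            → (Fin ν → ℚ) → (Fin (suc d) → ℚ) → Set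
SupportedOn {ν} {d} Y X y x =
  ((i : Fin ν) → i ∉ Y → y i ≡ 0ℚ) × ((i : Fin (suc d)) → i ∉ X → x i ≡ 0ℚ)

-- The columns of {y_i : i ∈ Y} ∪ {x_i : i ∈ X} in the (k+1) × (#vars)
-- constraint matrix (rows c_0,…,c_k), as a family of vectors in ℚ^{k+1}.
-- Linear independence of that family:
ColumnsIndependent : (ν d k : ℕ) → Subset ν → Subset (suc d) → Set
ColumnsIndependent ν d k Y X =
  (y : Fin ν → ℚ) (x : Fin (suc d) → ℚ) → SupportedOn Y X y x →
  ((h : Fin (suc k)) → lhs ν d k (toℕ h) y x ≡ 0ℚ) →
  ((i : Fin ν) → y i ≡ 0ℚ) × ((i : Fin (suc d)) → x i ≡ 0ℚ)

ColumnsSpan : (ν d k : ℕ) → Subset ν → Subset (suc d) → Set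
ColumnsSpan ν d k Y X =
  (b : Fin (suc k) → ℚ) →
  Σ (Fin ν → ℚ) λ y → Σ (Fin (suc d) → ℚ) λ x →
    SupportedOn Y X y x × ((h : Fin (suc k)) → lhs ν d k (toℕ h) y x ≡ b h)

IsBase : (ν d k : ℕ) → Subset ν → Subset (suc d) → Set
IsBase ν d k Y X = ColumnsIndependent ν d k Y X × ColumnsSpan ν d k Y X

IsBasicSolution : (ν d k : ℕ) → Subset ν → Subset (suc d)
                → (Fin ν → ℚ) → (Fin (suc d) → ℚ) → Set
IsBasicSolution ν d k Y X y x =
  SupportedOn Y X y x × ((h : Fin (suc k)) → lhs ν d k (toℕ h) y x ≡ rhs k (toℕ h))

-- Feasible: the basic solution has all coordinates non-negative.
-- (For a base the basic solution exists and is unique.)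
Feasible : (ν d k : ℕ) → Subset ν → Subset (suc d) → Set
Feasible ν d k Y X =
  Σ (Fin ν → ℚ) λ y → Σ (Fin (suc d) → ℚ) λ x →
    IsBasicSolution ν d k Y X y x ×
    ((i : Fin ν) → 0ℚ ≤ y i) × ((i : Fin (suc d)) → 0ℚ ≤ x i)

data Tag : Set where
  tX tY : Tag

other : Tag → Tag
other tX = tY
other tY = tX

-- membership of a natural number index in a subset of Fin n
-- (false for indices ≥ n)
memℕ : {n : ℕ} → Subset n → ℕ → Bool
memℕ [] i = false
memℕ (b ∷ᵛ S) zero = b
memℕ (b ∷ᵛ S) (suc i) = memℕ S i

tagsAt : {ν d : ℕ} → Subset ν → Subset (suc d) → ℕ → List Tag
tagsAt Y X i =
  (if memℕ X i then tX ∷ [] else []) ++ (if memℕ Y i then tY ∷ [] else [])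

tagsBelow : {ν d : ℕ} → Subset ν → Subset (suc d) → ℕ → List Tag
tagsBelow Y X zero = []
tagsBelow Y X (suc n) = tagsAt Y X n ++ tagsBelow Y X n

AlternatesFrom : Tag → List Tag → Set
AlternatesFrom t [] = ⊤
AlternatesFrom t (t' ∷ ts) = (t' ≡ t) × AlternatesFrom (other t) ts

-- Elements of Y ∪ X listed in decreasing order alternately belong to X and
-- Y, the largest belonging to X.  All elements are < ν since d < ν.
Alternating : (ν d : ℕ) → Subset ν → Subset (suc d) → Set
Alternating ν d Y X = AlternatesFrom tX (tagsBelow Y X ν)

{-# OPTIONS --safe #-}
module Submission where

-- Put z_t = x_t - y_t and u_t = C(ν,t) z_t for t < ν.  The identity
-- C(ν-k, t-h) ν↓k = C(ν,t) t↓h (ν-t)↓(k-h) turns (c_h), multiplied by ν↓k,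
-- into Σ_t u_t t↓h (ν-t)↓(k-h) = [h = k] ν↓k.  So u has the moments of the
-- unit point mass at ν in degree k, and then, because
-- (ν-a-b) t↓a (ν-t)↓b = t↓a (ν-t)↓(b+1) + t↓(a+1) (ν-t)↓b, in every degree
-- up to k.  Multiplying u by (t - c) keeps this property one degree lower and
-- scales the point mass by ν - c > 0.  Removing the points of Y ∪ X from the
-- top in this way shows that the weights u_t there are nonzero and alternate
-- in sign, starting positive at the largest point (X and Y are disjoint, as
-- the columns of x_t and y_t are opposite).  This needs at most k + 1
-- points: on k + 2 points there are weights, not all zero, annihilating every
-- degree up to k, and these would give a vanishing nontrivial combination of
-- the columns of the base.  Since u_t is a positive multiple of x_t on X and
-- of -y_t on Y, the basic solution is nonnegative exactly when X and Y
-- alternate downwards from an element of X.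

open import Data.Nat as ℕ using (ℕ; suc)
open import Data.Fin.Subset using (Subset)
open import Defs

module FallingFactorial where

  open import Data.Nat
  open import Data.Nat.Properties
  open import Data.Nat.Combinatorics using (_C_; k>n⇒nCk≡0; nCk≡n!/k![n-k]!; k![n∸k]!∣n!; [n-k]*[n-k-1]!≡[n-k]!)
  open import Data.Nat.DivMod using (m/n*n≡m)
  open import Data.Nat.Solver using (module +-*-Solver)
  open import Data.Bool using (true; false)
  open import Data.Unit using (tt)
  open import Data.Empty using (⊥-elim)
  open import Relation.Binary.PropositionalEquality
  open import Relation.Nullary using (yes; no)

  open +-*-Solver
  open ≡-Reasoning

  infixl 8 _↓_

  _↓_ : ℕ → ℕ → ℕ
  m ↓ zero  = 1
  m ↓ suc a = m ↓ a * (m ∸ a)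

  m<a⇒m↓a≡0 : ∀ {m a} → m < a → m ↓ a ≡ 0
  m<a⇒m↓a≡0 {m} {suc a} (s≤s m≤a) with m ≟ a
  ... | yes refl = trans (cong (m ↓ m *_) (n∸n≡0 m)) (*-zeroʳ (m ↓ m))
  ... | no m≢a   = cong (_* (m ∸ a)) (m<a⇒m↓a≡0 (≤∧≢⇒< m≤a m≢a))

  m↓a*[m∸a]!≡m! : ∀ {m a} → a ≤ m → m ↓ a * (m ∸ a) ! ≡ m !
  m↓a*[m∸a]!≡m! {m} {zero}  _   = +-identityʳ (m !)
  m↓a*[m∸a]!≡m! {m} {suc a} a<m = begin
    m ↓ a * (m ∸ a) * (m ∸ suc a) !   ≡⟨ *-assoc (m ↓ a) (m ∸ a) _ ⟩
    m ↓ a * ((m ∸ a) * (m ∸ suc a) !) ≡⟨ cong (m ↓ a *_) ([n-k]*[n-k-1]!≡[n-k]! a<m) ⟩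
    m ↓ a * (m ∸ a) !                 ≡⟨ m↓a*[m∸a]!≡m! (<⇒≤ a<m) ⟩
    m !                               ∎

  nCk*[k!*[n∸k]!]≡n! : ∀ {n k} → k ≤ n → (n C k) * (k ! * (n ∸ k) !) ≡ n !
  nCk*[k!*[n∸k]!]≡n! {n} {k} k≤n = begin
    (n C k) * (k ! * (n ∸ k) !)                 ≡⟨ cong (_* (k ! * (n ∸ k) !)) (nCk≡n!/k![n-k]! k≤n) ⟩
    (n ! / (k ! * (n ∸ k) !)) * (k ! * (n ∸ k) !) ≡⟨ m/n*n≡m (k![n∸k]!∣n! k≤n) ⟩
    n !                                           ∎
    where instance _ = k !* (n ∸ k) !≢0

  0<m↓a : ∀ {m a} → a ≤ m → 0 < m ↓ a
  0<m↓a {m} {a} a≤m = n≢0⇒n>0 λ m↓a≡0 → <⇒≢ (1≤n! m) (sym (begin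
    m !                 ≡⟨ m↓a*[m∸a]!≡m! a≤m ⟨
    m ↓ a * (m ∸ a) !   ≡⟨ cong (_* (m ∸ a) !) m↓a≡0 ⟩
    0                   ∎))

  0<nCk : ∀ {n k} → k ≤ n → 0 < n C k
  0<nCk {n} {k} k≤n = n≢0⇒n>0 λ nCk≡0 → <⇒≢ (1≤n! n) (sym (begin
    n !                         ≡⟨ nCk*[k!*[n∸k]!]≡n! k≤n ⟨
    (n C k) * (k ! * (n ∸ k) !) ≡⟨ cong (_* (k ! * (n ∸ k) !)) nCk≡0 ⟩
    0                           ∎))

  binomDiff-≤ : ∀ n {i h} → h ≤ i → binomDiff n i h ≡ n C (i ∸ h)
  binomDiff-≤ n {i} {h} h≤i with h ≤ᵇ i | ≤⇒≤ᵇ h≤i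
  ... | true | _ = refl

  binomDiff-> : ∀ n {i h} → i < h → binomDiff n i h ≡ 0
  binomDiff-> n {i} {h} i<h with h ≤ᵇ i | ≤ᵇ⇒≤ h i
  ... | true  | h≤i = ⊥-elim (<⇒≱ i<h (h≤i tt))
  ... | false | _   = refl

  private
    [a+b]↓a*b!≡[a+b]! : ∀ a b → (a + b) ↓ a * b ! ≡ (a + b) !
    [a+b]↓a*b!≡[a+b]! a b =
      subst (λ c → (a + b) ↓ a * c ! ≡ (a + b) !) (m+n∸m≡n a b) (m↓a*[m∸a]!≡m! (m≤m+n a b))

    [a+b]Ca*[a!*b!]≡[a+b]! : ∀ a b → ((a + b) C a) * (a ! * b !) ≡ (a + b) !
    [a+b]Ca*[a!*b!]≡[a+b]! a b =
      subst (λ c → ((a + b) C a) * (a ! * c !) ≡ (a + b) !) (m+n∸m≡n a b) (nCk*[k!*[n∸k]!]≡n! (m≤m+n a b))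

    -- Both sides, multiplied by j! s!, equal ν!.
    C↓-identity : ∀ h j r s → let ν = (h + r) + (j + s) in
                  ((j + s) C j) * ν ↓ (h + r) ≡ (ν C (h + j)) * ((h + j) ↓ h * (r + s) ↓ r)
    C↓-identity h j r s = *-cancelʳ-≡ _ _ (j ! * s !) {{j !* s !≢0}} (trans lhs≡ν! (sym rhs≡ν!))
      where
      ν = (h + r) + (j + s)
      ν≡ : ν ≡ (h + j) + (r + s)
      ν≡ = solve 4 (λ h r j s → (h :+ r) :+ (j :+ s) := (h :+ j) :+ (r :+ s)) refl h r j s
      lhs≡ν! : ((j + s) C j) * ν ↓ (h + r) * (j ! * s !) ≡ ν !
      lhs≡ν! = begin
        ((j + s) C j) * ν ↓ (h + r) * (j ! * s !)
          ≡⟨ solve 3 (λ c f g → c :* f :* g := f :* (c :* g)) refl ((j + s) C j) (ν ↓ (h + r)) (j ! * s !) ⟩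
        ν ↓ (h + r) * (((j + s) C j) * (j ! * s !))
          ≡⟨ cong (ν ↓ (h + r) *_) ([a+b]Ca*[a!*b!]≡[a+b]! j s) ⟩
        ν ↓ (h + r) * (j + s) !
          ≡⟨ [a+b]↓a*b!≡[a+b]! (h + r) (j + s) ⟩
        ν ! ∎
      rhs≡ν! : (ν C (h + j)) * ((h + j) ↓ h * (r + s) ↓ r) * (j ! * s !) ≡ ν !
      rhs≡ν! = begin
        (ν C (h + j)) * ((h + j) ↓ h * (r + s) ↓ r) * (j ! * s !)
          ≡⟨ solve 5 (λ c a b x y → c :* (a :* b) :* (x :* y) := c :* ((a :* x) :* (b :* y))) refl
               (ν C (h + j)) ((h + j) ↓ h) ((r + s) ↓ r) (j !) (s !) ⟩
        (ν C (h + j)) * (((h + j) ↓ h * j !) * ((r + s) ↓ r * s !))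
          ≡⟨ cong₂ (λ x y → (ν C (h + j)) * (x * y)) ([a+b]↓a*b!≡[a+b]! h j) ([a+b]↓a*b!≡[a+b]! r s) ⟩
        (ν C (h + j)) * ((h + j) ! * (r + s) !)
          ≡⟨ cong (λ n → (n C (h + j)) * ((h + j) ! * (r + s) !)) ν≡ ⟩
        (((h + j) + (r + s)) C (h + j)) * ((h + j) ! * (r + s) !)
          ≡⟨ [a+b]Ca*[a!*b!]≡[a+b]! (h + j) (r + s) ⟩
        ((h + j) + (r + s)) !
          ≡⟨ cong _! ν≡ ⟨
        ν ! ∎

    -- The cases below write i = h + j, k = h + r and ν = k + n, with n = j + s
    -- when j ≤ n, so that no truncated subtraction is left to reason about.
    Identity : ℕ → ℕ → ℕ → ℕ → Set
    Identity ν k i h = binomDiff (ν ∸ k) i h * ν ↓ k ≡ (ν C i) * (i ↓ h * (ν ∸ i) ↓ (k ∸ h))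

    identity-≤ : ∀ h j r s → Identity ((h + r) + (j + s)) (h + r) (h + j) h
    identity-≤ h j r s = begin
      binomDiff (ν ∸ (h + r)) (h + j) h * ν ↓ (h + r)
        ≡⟨ cong (λ n → binomDiff n (h + j) h * ν ↓ (h + r)) (m+n∸m≡n (h + r) (j + s)) ⟩
      binomDiff (j + s) (h + j) h * ν ↓ (h + r)
        ≡⟨ cong (_* ν ↓ (h + r)) (binomDiff-≤ (j + s) (m≤m+n h j)) ⟩
      ((j + s) C (h + j ∸ h)) * ν ↓ (h + r)
        ≡⟨ cong (λ x → ((j + s) C x) * ν ↓ (h + r)) (m+n∸m≡n h j) ⟩
      ((j + s) C j) * ν ↓ (h + r)
        ≡⟨ C↓-identity h j r s ⟩
      (ν C (h + j)) * ((h + j) ↓ h * (r + s) ↓ r)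
        ≡⟨ cong₂ (λ x y → (ν C (h + j)) * ((h + j) ↓ h * x ↓ y)) ν∸i≡r+s (m+n∸m≡n h r) ⟨
      (ν C (h + j)) * ((h + j) ↓ h * (ν ∸ (h + j)) ↓ ((h + r) ∸ h)) ∎
      where
      ν = (h + r) + (j + s)
      ν∸i≡r+s : ν ∸ (h + j) ≡ r + s
      ν∸i≡r+s = trans (cong (_∸ (h + j)) (solve 4 (λ h r j s → (h :+ r) :+ (j :+ s) := (h :+ j) :+ (r :+ s)) refl h r j s))
                      (m+n∸m≡n (h + j) (r + s))

    ν∸i<k∸h : ∀ h j r n → n < j → h + j ≤ (h + r) + n → ((h + r) + n) ∸ (h + j) < (h + r) ∸ h
    ν∸i<k∸h h j zero n n<j i≤ν =
      ⊥-elim (<⇒≱ n<j (+-cancelˡ-≤ h j n (subst (h + j ≤_) (cong (_+ n) (+-identityʳ h)) i≤ν)))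
    ν∸i<k∸h h j r@(suc _) n n<j _ = subst₂ _<_ (sym ν∸i≡) (sym (m+n∸m≡n h r)) (m<n+o⇒m∸n<o (r + n) j r+n<j+r)
      where
      ν∸i≡ : ((h + r) + n) ∸ (h + j) ≡ (r + n) ∸ j
      ν∸i≡ = trans (cong (_∸ (h + j)) (+-assoc h r n)) ([m+n]∸[m+o]≡n∸o h (r + n) j)
      r+n<j+r : r + n < j + r
      r+n<j+r = subst (_< j + r) (+-comm n r) (+-monoˡ-< r n<j)

    identity-> : ∀ h j r n → n < j → h + j ≤ (h + r) + n → Identity ((h + r) + n) (h + r) (h + j) h
    identity-> h j r n n<j i≤ν = begin
      binomDiff (ν ∸ (h + r)) (h + j) h * ν ↓ (h + r)
        ≡⟨ cong (λ n → binomDiff n (h + j) h * ν ↓ (h + r)) (m+n∸m≡n (h + r) n) ⟩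
      binomDiff n (h + j) h * ν ↓ (h + r)
        ≡⟨ cong (_* ν ↓ (h + r)) (binomDiff-≤ n (m≤m+n h j)) ⟩
      (n C (h + j ∸ h)) * ν ↓ (h + r)
        ≡⟨ cong (λ x → (n C x) * ν ↓ (h + r)) (m+n∸m≡n h j) ⟩
      (n C j) * ν ↓ (h + r)
        ≡⟨ cong (_* ν ↓ (h + r)) (k>n⇒nCk≡0 n<j) ⟩
      0
        ≡⟨ trans (cong ((ν C (h + j)) *_) (*-zeroʳ ((h + j) ↓ h))) (*-zeroʳ (ν C (h + j))) ⟨
      (ν C (h + j)) * ((h + j) ↓ h * 0)
        ≡⟨ cong (λ x → (ν C (h + j)) * ((h + j) ↓ h * x)) (m<a⇒m↓a≡0 (ν∸i<k∸h h j r n n<j i≤ν)) ⟨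
      (ν C (h + j)) * ((h + j) ↓ h * (ν ∸ (h + j)) ↓ ((h + r) ∸ h)) ∎
      where ν = (h + r) + n

    identity-≤-via : ∀ {ν k i h} j r s → h + j ≡ i → h + r ≡ k → (h + r) + (j + s) ≡ ν → Identity ν k i h
    identity-≤-via {h = h} j r s refl refl refl = identity-≤ h j r s

    identity->-via : ∀ {ν k i h} j r n → h + j ≡ i → h + r ≡ k → (h + r) + n ≡ ν →
                     n < j → i ≤ ν → Identity ν k i h
    identity->-via {h = h} j r n refl refl refl = identity-> h j r n

  binomDiff*↓≡C*[↓*↓] : ∀ {ν k i h} → k ≤ ν → i ≤ ν → h ≤ k →
                        binomDiff (ν ∸ k) i h * ν ↓ k ≡ (ν C i) * (i ↓ h * (ν ∸ i) ↓ (k ∸ h))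
  binomDiff*↓≡C*[↓*↓] {ν} {k} {i} {h} k≤ν i≤ν h≤k with h ≤? i | i ∸ h ≤? ν ∸ k
  ... | yes h≤i | yes j≤n =
    identity-≤-via (i ∸ h) (k ∸ h) (ν ∸ k ∸ (i ∸ h)) (m+[n∸m]≡n h≤i) (m+[n∸m]≡n h≤k)
      (trans (cong₂ _+_ (m+[n∸m]≡n h≤k) (m+[n∸m]≡n j≤n)) (m+[n∸m]≡n k≤ν))
  ... | yes h≤i | no j≰n =
    identity->-via (i ∸ h) (k ∸ h) (ν ∸ k) (m+[n∸m]≡n h≤i) (m+[n∸m]≡n h≤k)
      (trans (cong (_+ (ν ∸ k)) (m+[n∸m]≡n h≤k)) (m+[n∸m]≡n k≤ν)) (≰⇒> j≰n) i≤ν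
  ... | no h≰i | _ = begin
    binomDiff (ν ∸ k) i h * ν ↓ k         ≡⟨ cong (_* ν ↓ k) (binomDiff-> (ν ∸ k) (≰⇒> h≰i)) ⟩
    0                                     ≡⟨ *-zeroʳ (ν C i) ⟨
    (ν C i) * 0                           ≡⟨ cong (λ x → (ν C i) * (x * (ν ∸ i) ↓ (k ∸ h))) (m<a⇒m↓a≡0 (≰⇒> h≰i)) ⟨
    (ν C i) * (i ↓ h * (ν ∸ i) ↓ (k ∸ h)) ∎

module RationalArithmetic where

  open import Data.Nat as ℕ using (ℕ; zero; suc)
  import Data.Nat.Properties as ℕ
  open import Data.Integer as ℤ using (+_)
  import Data.Integer.Properties as ℤ
  open import Data.Rational
  open import Data.Rational.Properties
  import Data.Rational.Unnormalised as ℚᵘ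
  import Data.Rational.Unnormalised.Properties as ℚᵘ
  open import Data.Rational.Solver using (module +-*-Solver)
  open import Data.Bool using (Bool; true; false; not)
  open import Data.Empty using (⊥-elim)
  open import Function.Bundles using (_⇔_; mk⇔)
  open import Relation.Binary.PropositionalEquality
  open import Relation.Nullary using (yes; no)
  open import Relation.Binary.Definitions using (tri<; tri≈; tri>)
  open FallingFactorial using (_↓_; m<a⇒m↓a≡0)

  open +-*-Solver

  private
    toℚᵘ-ℕ→ℚ : ∀ n → toℚᵘ (ℕ→ℚ n) ℚᵘ.≃ ℚᵘ.mkℚᵘ (+ n) 0
    toℚᵘ-ℕ→ℚ n = toℚᵘ-fromℚᵘ (ℚᵘ.mkℚᵘ (+ n) 0)

  ℕ→ℚ-+ : ∀ m n → ℕ→ℚ (m ℕ.+ n) ≡ ℕ→ℚ m + ℕ→ℚ n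
  ℕ→ℚ-+ m n = toℚᵘ-injective (ℚᵘ.≃-trans (toℚᵘ-ℕ→ℚ (m ℕ.+ n)) (ℚᵘ.≃-sym (ℚᵘ.≃-trans
    (toℚᵘ-homo-+ (ℕ→ℚ m) (ℕ→ℚ n)) (ℚᵘ.≃-trans (ℚᵘ.+-cong (toℚᵘ-ℕ→ℚ m) (toℚᵘ-ℕ→ℚ n)) (ℚᵘ.*≡* eq)))))
    where
    eq : (+ m ℤ.* + 1 ℤ.+ + n ℤ.* + 1) ℤ.* + 1 ≡ + (m ℕ.+ n) ℤ.* + 1
    eq = cong (ℤ._* + 1) (trans (cong₂ ℤ._+_ (ℤ.*-identityʳ (+ m)) (ℤ.*-identityʳ (+ n))) (sym (ℤ.pos-+ m n)))

  ℕ→ℚ-* : ∀ m n → ℕ→ℚ (m ℕ.* n) ≡ ℕ→ℚ m * ℕ→ℚ n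
  ℕ→ℚ-* m n = toℚᵘ-injective (ℚᵘ.≃-trans (toℚᵘ-ℕ→ℚ (m ℕ.* n)) (ℚᵘ.≃-sym (ℚᵘ.≃-trans
    (toℚᵘ-homo-* (ℕ→ℚ m) (ℕ→ℚ n)) (ℚᵘ.≃-trans (ℚᵘ.*-cong (toℚᵘ-ℕ→ℚ m) (toℚᵘ-ℕ→ℚ n)) (ℚᵘ.*≡* eq)))))
    where
    eq : (+ m ℤ.* + n) ℤ.* + 1 ≡ + (m ℕ.* n) ℤ.* + 1
    eq = cong (ℤ._* + 1) (sym (ℤ.pos-* m n))

  ℕ→ℚ-∸ : ∀ {m n} → n ℕ.≤ m → ℕ→ℚ (m ℕ.∸ n) ≡ ℕ→ℚ m - ℕ→ℚ n
  ℕ→ℚ-∸ {m} {n} n≤m = begin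
    ℕ→ℚ (m ℕ.∸ n)                       ≡⟨ solve 2 (λ a b → a := (a :+ b) :- b) refl (ℕ→ℚ (m ℕ.∸ n)) (ℕ→ℚ n) ⟩
    (ℕ→ℚ (m ℕ.∸ n) + ℕ→ℚ n) - ℕ→ℚ n     ≡⟨ cong (_- ℕ→ℚ n) (ℕ→ℚ-+ (m ℕ.∸ n) n) ⟨
    ℕ→ℚ (m ℕ.∸ n ℕ.+ n) - ℕ→ℚ n         ≡⟨ cong (λ k → ℕ→ℚ k - ℕ→ℚ n) (ℕ.m∸n+n≡m n≤m) ⟩
    ℕ→ℚ m - ℕ→ℚ n                       ∎
    where open ≡-Reasoning

  0<ℕ→ℚ : ∀ {n} → 0 ℕ.< n → 0ℚ < ℕ→ℚ n
  0<ℕ→ℚ {suc n} _ = positive⁻¹ (ℕ→ℚ (suc n)) {{normalize-pos (suc n) 1}}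

  0≤ℕ→ℚ : ∀ n → 0ℚ ≤ ℕ→ℚ n
  0≤ℕ→ℚ n = nonNegative⁻¹ (ℕ→ℚ n) {{normalize-nonNeg n 1}}

  p<q⇒0<q-p : ∀ {p q} → p < q → 0ℚ < q - p
  p<q⇒0<q-p {p} {q} p<q = subst (_< q - p) (+-inverseʳ p) (+-monoˡ-< (- p) p<q)

  0<q-p⇒p<q : ∀ {p q} → 0ℚ < q - p → p < q
  0<q-p⇒p<q {p} {q} 0<q-p =
    subst₂ _<_ (+-identityˡ p) (solve 2 (λ p q → (q :- p) :+ p := q) refl p q) (+-monoˡ-< p 0<q-p)

  ℕ→ℚ-mono-< : ∀ {m n} → m ℕ.< n → ℕ→ℚ m < ℕ→ℚ n
  ℕ→ℚ-mono-< {m} {n} m<n =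
    0<q-p⇒p<q (subst (0ℚ <_) (ℕ→ℚ-∸ (ℕ.<⇒≤ m<n)) (0<ℕ→ℚ (ℕ.m<n⇒0<n∸m m<n)))

  p<q⇒p-q<0 : ∀ {p q} → p < q → p - q < 0ℚ
  p<q⇒p-q<0 {p} {q} p<q = subst (_< 0ℚ) (solve 2 (λ p q → :- (q :- p) := p :- q) refl p q) (neg-antimono-< (p<q⇒0<q-p p<q))

  ℕ→ℚ-≢⇒-≢0 : ∀ {m n} → m ≢ n → ℕ→ℚ m - ℕ→ℚ n ≢ 0ℚ
  ℕ→ℚ-≢⇒-≢0 {m} {n} m≢n with ℕ.<-cmp m n
  ... | tri< m<n _ _ = λ eq → <-irrefl eq (p<q⇒p-q<0 (ℕ→ℚ-mono-< m<n))
  ... | tri≈ _ m≡n _ = ⊥-elim (m≢n m≡n)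
  ... | tri> _ _ n<m = λ eq → <-irrefl (sym eq) (p<q⇒0<q-p (ℕ→ℚ-mono-< n<m))

  0<* : ∀ {p q} → 0ℚ < p → 0ℚ < q → 0ℚ < p * q
  0<* {p} {q} 0<p 0<q = positive⁻¹ (p * q) {{pos*pos⇒pos p {{positive 0<p}} q {{positive 0<q}}}}

  *-cancelˡ-≡-pos : ∀ r {p q} → 0ℚ < r → r * p ≡ r * q → p ≡ q
  *-cancelˡ-≡-pos r 0<r rp≡rq = ≤-antisym (cancel (≤-reflexive rp≡rq)) (cancel (≤-reflexive (sym rp≡rq)))
    where
    cancel : ∀ {x y} → r * x ≤ r * y → x ≤ y
    cancel = *-cancelˡ-≤-pos r {{positive 0<r}}

  -- The junk value recip 0ℚ = 0ℚ keeps it total.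
  recip : ℚ → ℚ
  recip p with p ≟ 0ℚ
  ... | yes _   = 0ℚ
  ... | no p≢0 = 1/ p
    where instance _ = ≢-nonZero p≢0

  *-recip : ∀ {p} → p ≢ 0ℚ → p * recip p ≡ 1ℚ
  *-recip {p} p≢0 with p ≟ 0ℚ
  ... | yes p≡0 = ⊥-elim (p≢0 p≡0)
  ... | no p≢0′ = *-inverseʳ p
    where instance _ = ≢-nonZero p≢0′

  Sign : Bool → ℚ → Set
  Sign true  q = 0ℚ < q
  Sign false q = q < 0ℚ

  sign-*-pos⁻¹ : ∀ {a q} b → 0ℚ < a → Sign b (a * q) → Sign b q
  sign-*-pos⁻¹ {a} {q} true  0<a 0<aq = *-cancelˡ-<-nonNeg a (subst (_< a * q) (sym (*-zeroʳ a)) 0<aq)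
    where instance _ = nonNegative (<⇒≤ 0<a)
  sign-*-pos⁻¹ {a} {q} false 0<a aq<0 = *-cancelˡ-<-nonNeg a (subst (a * q <_) (sym (*-zeroʳ a)) aq<0)
    where instance _ = nonNegative (<⇒≤ 0<a)

  sign-*-neg⁻¹ : ∀ {a q} b → a < 0ℚ → Sign b (a * q) → Sign (not b) q
  sign-*-neg⁻¹ {a} {q} true  a<0 0<aq = *-cancelˡ-<-nonPos a (subst (_< a * q) (sym (*-zeroʳ a)) 0<aq)
    where instance _ = nonPositive (<⇒≤ a<0)
  sign-*-neg⁻¹ {a} {q} false a<0 aq<0 = *-cancelˡ-<-nonPos a (subst (a * q <_) (sym (*-zeroʳ a)) aq<0)
    where instance _ = nonPositive (<⇒≤ a<0)

  infixl 8 _↓ℚ_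

  _↓ℚ_ : ℚ → ℕ → ℚ
  x ↓ℚ zero  = 1ℚ
  x ↓ℚ suc a = x ↓ℚ a * (x - ℕ→ℚ a)

  ℕ→ℚ-↓ : ∀ m a → ℕ→ℚ m ↓ℚ a ≡ ℕ→ℚ (m ↓ a)
  ℕ→ℚ-↓ m zero    = refl
  ℕ→ℚ-↓ m (suc a) with a ℕ.≤? m
  ... | yes a≤m = trans (cong₂ _*_ (ℕ→ℚ-↓ m a) (sym (ℕ→ℚ-∸ a≤m))) (sym (ℕ→ℚ-* (m ↓ a) (m ℕ.∸ a)))
  ... | no  a≰m = begin
    ℕ→ℚ m ↓ℚ a * (ℕ→ℚ m - ℕ→ℚ a) ≡⟨ cong (_* (ℕ→ℚ m - ℕ→ℚ a)) (trans (ℕ→ℚ-↓ m a) (cong ℕ→ℚ m↓a≡0)) ⟩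
    0ℚ * (ℕ→ℚ m - ℕ→ℚ a)          ≡⟨ *-zeroˡ (ℕ→ℚ m - ℕ→ℚ a) ⟩
    0ℚ                            ≡⟨ cong (λ n → ℕ→ℚ (n ℕ.* (m ℕ.∸ a))) m↓a≡0 ⟨
    ℕ→ℚ (m ↓ a ℕ.* (m ℕ.∸ a))     ∎
    where
    open ≡-Reasoning
    m↓a≡0 : m ↓ a ≡ 0
    m↓a≡0 = m<a⇒m↓a≡0 (ℕ.≰⇒> a≰m)

  0ℚ↓ℚsuc : ∀ a → 0ℚ ↓ℚ suc a ≡ 0ℚ
  0ℚ↓ℚsuc zero    = refl
  0ℚ↓ℚsuc (suc a) = trans (cong (_* (0ℚ - ℕ→ℚ (suc a))) (0ℚ↓ℚsuc a)) (*-zeroˡ (0ℚ - ℕ→ℚ (suc a)))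

  WeakSign : Bool → ℚ → Set
  WeakSign true  q = 0ℚ ≤ q
  WeakSign false q = q ≤ 0ℚ

  sign⇒weakSign : ∀ {q} b → Sign b q → WeakSign b q
  sign⇒weakSign true  = <⇒≤
  sign⇒weakSign false = <⇒≤

  weakSign⇔≡ : ∀ {q} b c → Sign b q → WeakSign c q ⇔ c ≡ b
  weakSign⇔≡ true  true  s = mk⇔ (λ _ → refl) (λ _ → sign⇒weakSign true s)
  weakSign⇔≡ false false s = mk⇔ (λ _ → refl) (λ _ → sign⇒weakSign false s)
  weakSign⇔≡ true  false 0<q = mk⇔ (λ q≤0 → ⊥-elim (<-irrefl refl (<-≤-trans 0<q q≤0))) (λ ())
  weakSign⇔≡ false true  q<0 = mk⇔ (λ 0≤q → ⊥-elim (<-irrefl refl (<-≤-trans q<0 0≤q))) (λ ())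

  weakSign-*-nonneg : ∀ {c q} b → 0ℚ ≤ c → WeakSign b q → WeakSign b (c * q)
  weakSign-*-nonneg {c} {q} true  0≤c 0≤q = subst (_≤ c * q) (*-zeroʳ c) (*-monoˡ-≤-nonNeg c 0≤q)
    where instance _ = nonNegative 0≤c
  weakSign-*-nonneg {c} {q} false 0≤c q≤0 = subst (c * q ≤_) (*-zeroʳ c) (*-monoˡ-≤-nonNeg c q≤0)
    where instance _ = nonNegative 0≤c

  weakSign-*-pos⁻¹ : ∀ {c q} b → 0ℚ < c → WeakSign b (c * q) → WeakSign b q
  weakSign-*-pos⁻¹ {c} {q} true  0<c 0≤cq = *-cancelˡ-≤-pos c (subst (_≤ c * q) (sym (*-zeroʳ c)) 0≤cq)
    where instance _ = positive 0<c
  weakSign-*-pos⁻¹ {c} {q} false 0<c cq≤0 = *-cancelˡ-≤-pos c (subst (c * q ≤_) (sym (*-zeroʳ c)) cq≤0)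
    where instance _ = positive 0<c

module FiniteSums where

  open import Data.Nat as ℕ using (ℕ; zero; suc; z≤n; s≤s)
  import Data.Nat.Properties as ℕ
  open import Data.Fin as Fin using (Fin; toℕ)
  open import Data.Rational
  open import Data.Rational.Properties
  open import Data.Rational.Solver using (module +-*-Solver)
  open import Function using (_∘_)
  open import Relation.Binary.PropositionalEquality

  open +-*-Solver

  Σℕ[<_]_ : ℕ → (ℕ → ℚ) → ℚ
  Σℕ[< zero  ] F = 0ℚ
  Σℕ[< suc N ] F = F 0 + Σℕ[< N ] (F ∘ suc)

  Σℕ-cong : ∀ N {F G : ℕ → ℚ} → (∀ t → t ℕ.< N → F t ≡ G t) → Σℕ[< N ] F ≡ Σℕ[< N ] G
  Σℕ-cong zero    F≡G = refl
  Σℕ-cong (suc N) F≡G = cong₂ _+_ (F≡G 0 (s≤s z≤n)) (Σℕ-cong N (λ t t<N → F≡G (suc t) (s≤s t<N)))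

  Σℕ-+ : ∀ N (F G : ℕ → ℚ) → Σℕ[< N ] (λ t → F t + G t) ≡ Σℕ[< N ] F + Σℕ[< N ] G
  Σℕ-+ zero    F G = refl
  Σℕ-+ (suc N) F G = trans (cong (F 0 + G 0 +_) (Σℕ-+ N (F ∘ suc) (G ∘ suc)))
    (solve 4 (λ a b c d → (a :+ b) :+ (c :+ d) := (a :+ c) :+ (b :+ d)) refl (F 0) (G 0) _ _)

  Σℕ-*ˡ : ∀ N c (F : ℕ → ℚ) → Σℕ[< N ] (λ t → c * F t) ≡ c * Σℕ[< N ] F
  Σℕ-*ˡ zero    c F = sym (*-zeroʳ c)
  Σℕ-*ˡ (suc N) c F = trans (cong (c * F 0 +_) (Σℕ-*ˡ N c (F ∘ suc))) (sym (*-distribˡ-+ c (F 0) _))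

  Σℕ-neg : ∀ N (F : ℕ → ℚ) → Σℕ[< N ] (λ t → - F t) ≡ - Σℕ[< N ] F
  Σℕ-neg zero    F = refl
  Σℕ-neg (suc N) F = trans (cong (- F 0 +_) (Σℕ-neg N (F ∘ suc))) (sym (neg-distrib-+ (F 0) _))

  Σℕ-- : ∀ N (F G : ℕ → ℚ) → Σℕ[< N ] (λ t → F t - G t) ≡ Σℕ[< N ] F - Σℕ[< N ] G
  Σℕ-- N F G = trans (Σℕ-+ N F (λ t → - G t)) (cong (Σℕ[< N ] F +_) (Σℕ-neg N G))

  Σℕ-0 : ∀ N (F : ℕ → ℚ) → (∀ t → t ℕ.< N → F t ≡ 0ℚ) → Σℕ[< N ] F ≡ 0ℚ
  Σℕ-0 zero    F F≡0 = refl
  Σℕ-0 (suc N) F F≡0 = cong₂ _+_ (F≡0 0 (s≤s z≤n)) (Σℕ-0 N (F ∘ suc) (λ t t<N → F≡0 (suc t) (s≤s t<N)))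

  Σℕ-point : ∀ N (F : ℕ → ℚ) {c} → c ℕ.< N → (∀ t → t ≢ c → F t ≡ 0ℚ) → Σℕ[< N ] F ≡ F c
  Σℕ-point (suc N) F {zero} _ F≡0 =
    trans (cong (F 0 +_) (Σℕ-0 N (F ∘ suc) (λ t _ → F≡0 (suc t) λ ()))) (+-identityʳ (F 0))
  Σℕ-point (suc N) F {suc c} (s≤s c<N) F≡0 =
    trans (cong₂ _+_ (F≡0 0 λ ()) (Σℕ-point N (F ∘ suc) c<N (λ t t≢c → F≡0 (suc t) (t≢c ∘ ℕ.suc-injective))))
          (+-identityˡ (F (suc c)))

  padZero : ∀ {m} → (Fin m → ℚ) → ℕ → ℚ
  padZero {zero}  f t       = 0ℚ
  padZero {suc m} f zero    = f Fin.zero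
  padZero {suc m} f (suc t) = padZero (f ∘ Fin.suc) t

  padZero-toℕ : ∀ {m} (f : Fin m → ℚ) i → padZero f (toℕ i) ≡ f i
  padZero-toℕ f Fin.zero    = refl
  padZero-toℕ f (Fin.suc i) = padZero-toℕ (f ∘ Fin.suc) i

  padZero-∘toℕ : ∀ {m} (F : ℕ → ℚ) → (∀ t → m ℕ.≤ t → F t ≡ 0ℚ) → ∀ t → padZero {m} (F ∘ toℕ) t ≡ F t
  padZero-∘toℕ {zero}  F F≡0 t       = sym (F≡0 t z≤n)
  padZero-∘toℕ {suc m} F F≡0 zero    = refl
  padZero-∘toℕ {suc m} F F≡0 (suc t) = padZero-∘toℕ (F ∘ suc) (λ t m≤t → F≡0 (suc t) (s≤s m≤t)) t

  Σ[<]≡Σℕ-padZero : ∀ {m N} (F : ℕ → ℚ) (f : Fin m → ℚ) → m ℕ.≤ N →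
                    Σ[< m ] (λ i → F (toℕ i) * f i) ≡ Σℕ[< N ] (λ t → F t * padZero f t)
  Σ[<]≡Σℕ-padZero {zero}  {N}     F f _         = sym (Σℕ-0 N _ (λ t _ → *-zeroʳ (F t)))
  Σ[<]≡Σℕ-padZero {suc m} {suc N} F f (s≤s m≤N) = cong (F 0 * f Fin.zero +_) (Σ[<]≡Σℕ-padZero (F ∘ suc) (f ∘ Fin.suc) m≤N)

  padZero-≡0 : ∀ {m} (f : Fin m → ℚ) → (∀ i → f i ≡ 0ℚ) → ∀ t → padZero f t ≡ 0ℚ
  padZero-≡0 {zero}  f f≡0 t       = refl
  padZero-≡0 {suc m} f f≡0 zero    = f≡0 Fin.zero
  padZero-≡0 {suc m} f f≡0 (suc t) = padZero-≡0 (f ∘ Fin.suc) (f≡0 ∘ Fin.suc) t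

  padZero-nonneg : ∀ {m} (f : Fin m → ℚ) → (∀ i → 0ℚ ≤ f i) → ∀ t → 0ℚ ≤ padZero f t
  padZero-nonneg {zero}  f 0≤f t       = ≤-refl
  padZero-nonneg {suc m} f 0≤f zero    = 0≤f Fin.zero
  padZero-nonneg {suc m} f 0≤f (suc t) = padZero-nonneg (f ∘ Fin.suc) (0≤f ∘ Fin.suc) t

module SubsetMembership where

  open import Data.Nat as ℕ using (ℕ; zero; suc; z≤n; s≤s)
  open import Data.Fin as Fin using (Fin; toℕ)
  open import Data.Fin.Subset using (Subset; _∈_; _∉_)
  open import Data.Vec using ([]; _∷_; here; there)
  open import Data.Bool using (true; false)
  open import Data.Rational using (ℚ; 0ℚ)
  open import Function using (_∘_)
  open import Data.Empty using (⊥-elim)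
  open import Relation.Binary.PropositionalEquality
  open FiniteSums using (padZero)

  memℕ⇒∈ : ∀ {n} (S : Subset n) i → memℕ S (toℕ i) ≡ true → i ∈ S
  memℕ⇒∈ (true ∷ S) Fin.zero    refl = here
  memℕ⇒∈ (_ ∷ S)    (Fin.suc i) eq   = there (memℕ⇒∈ S i eq)

  ∈⇒memℕ : ∀ {n} (S : Subset n) i → i ∈ S → memℕ S (toℕ i) ≡ true
  ∈⇒memℕ (_ ∷ S) Fin.zero    here      = refl
  ∈⇒memℕ (_ ∷ S) (Fin.suc i) (there p) = ∈⇒memℕ S i p

  ∉⇒memℕ : ∀ {n} (S : Subset n) i → i ∉ S → memℕ S (toℕ i) ≡ false
  ∉⇒memℕ S i i∉S with memℕ S (toℕ i) in eq
  ... | true  = ⊥-elim (i∉S (memℕ⇒∈ S i eq))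
  ... | false = refl

  memℕ⇒< : ∀ {n} (S : Subset n) j → memℕ S j ≡ true → j ℕ.< n
  memℕ⇒< (_ ∷ S) zero    _  = s≤s z≤n
  memℕ⇒< (_ ∷ S) (suc j) eq = s≤s (memℕ⇒< S j eq)

  memℕ-≥ : ∀ {n} (S : Subset n) j → n ℕ.≤ j → memℕ S j ≡ false
  memℕ-≥ []      j       _         = refl
  memℕ-≥ (_ ∷ S) (suc j) (s≤s n≤j) = memℕ-≥ S j n≤j

  padZero-vanishes : ∀ {n} (S : Subset n) (f : Fin n → ℚ) → (∀ i → i ∉ S → f i ≡ 0ℚ) →
                     ∀ j → memℕ S j ≡ false → padZero f j ≡ 0ℚ
  padZero-vanishes []          f _   j       _    = refl
  padZero-vanishes (false ∷ S) f f≡0 zero    refl = f≡0 Fin.zero λ ()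
  padZero-vanishes (_ ∷ S)     f f≡0 (suc j) eq   =
    padZero-vanishes S (f ∘ Fin.suc) (λ i i∉S → f≡0 (Fin.suc i) λ { (there i∈S) → i∉S i∈S }) j eq

module Moments (ν : ℕ) where

  open import Data.Nat as ℕ using (ℕ; zero; suc; z≤n; s≤s)
  import Data.Nat.Properties as ℕ
  open import Data.Rational
  open import Data.Rational.Properties
  open import Data.Rational.Solver using (module +-*-Solver)
  open import Data.Bool using (Bool; true; not)
  open import Data.List using (List; []; _∷_; length)
  open import Data.List.Relation.Unary.All using (All; []; _∷_)
  open import Data.List.Relation.Unary.All.Properties using (All¬⇒¬Any)
  open import Data.List.Relation.Unary.AllPairs using (AllPairs; []; _∷_)
  open import Data.List.Relation.Unary.Any using (here; there)
  open import Data.List.Relation.Unary.Unique.Propositional using (Unique)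
  open import Data.List.Membership.Propositional using (_∈_; _∉_)
  open import Data.List.Relation.Binary.Subset.Propositional using (_⊆_)
  open import Data.Product using (Σ-syntax; ∃-syntax; _×_; _,_)
  open import Data.Unit using (⊤; tt)
  open import Data.Empty using (⊥-elim)
  open import Function using (_∘_)
  open import Relation.Binary.PropositionalEquality
  open import Relation.Nullary using (yes; no)
  open RationalArithmetic
  open FiniteSums

  open +-*-Solver
  open ≡-Reasoning

  bernstein : ℕ → ℕ → ℕ → ℚ
  bernstein a b t = ℕ→ℚ t ↓ℚ a * (ℕ→ℚ ν - ℕ→ℚ t) ↓ℚ b

  bernstein-shift : ∀ a b c t → (ℕ→ℚ t - ℕ→ℚ c) * bernstein a b t
                              ≡ bernstein (suc a) b t + (ℕ→ℚ a - ℕ→ℚ c) * bernstein a b t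
  bernstein-shift a b c t =
    solve 5 (λ x c a p q → (x :- c) :* (p :* q) := (p :* (x :- a)) :* q :+ (a :- c) :* (p :* q)) refl
      (ℕ→ℚ t) (ℕ→ℚ c) (ℕ→ℚ a) (ℕ→ℚ t ↓ℚ a) ((ℕ→ℚ ν - ℕ→ℚ t) ↓ℚ b)

  bernstein-split : ∀ a b t → (ℕ→ℚ ν - ℕ→ℚ a - ℕ→ℚ b) * bernstein a b t
                            ≡ bernstein a (suc b) t + bernstein (suc a) b t
  bernstein-split a b t =
    solve 6 (λ x n a b p q → (n :- a :- b) :* (p :* q) := p :* (q :* ((n :- x) :- b)) :+ (p :* (x :- a)) :* q) refl
      (ℕ→ℚ t) (ℕ→ℚ ν) (ℕ→ℚ a) (ℕ→ℚ b) (ℕ→ℚ t ↓ℚ a) ((ℕ→ℚ ν - ℕ→ℚ t) ↓ℚ b)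

  ⟪_,_⟫ : (ℕ → ℚ) → (ℕ → ℚ) → ℚ
  ⟪ u , f ⟫ = Σℕ[< ν ] (λ t → u t * f t)

  ⟪⟫-congˡ : ∀ {u v} f → (∀ t → t ℕ.< ν → u t ≡ v t) → ⟪ u , f ⟫ ≡ ⟪ v , f ⟫
  ⟪⟫-congˡ f u≡v = Σℕ-cong ν (λ t t<ν → cong (_* f t) (u≡v t t<ν))

  ⟪⟫-zeroˡ : ∀ {u} f → (∀ t → t ℕ.< ν → u t ≡ 0ℚ) → ⟪ u , f ⟫ ≡ 0ℚ
  ⟪⟫-zeroˡ {u} f u≡0 = Σℕ-0 ν (λ t → u t * f t) (λ t t<ν → trans (cong (_* f t) (u≡0 t t<ν)) (*-zeroˡ (f t)))

  ⟪⟫-+ˡ : ∀ u v f → ⟪ (λ t → u t + v t) , f ⟫ ≡ ⟪ u , f ⟫ + ⟪ v , f ⟫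
  ⟪⟫-+ˡ u v f = trans (Σℕ-cong ν (λ t _ → *-distribʳ-+ (f t) (u t) (v t))) (Σℕ-+ ν _ _)

  ⟪⟫-congʳ : ∀ u {f g} → (∀ t → f t ≡ g t) → ⟪ u , f ⟫ ≡ ⟪ u , g ⟫
  ⟪⟫-congʳ u f≡g = Σℕ-cong ν (λ t _ → cong (u t *_) (f≡g t))

  ⟪⟫-+ʳ : ∀ u f g → ⟪ u , (λ t → f t + g t) ⟫ ≡ ⟪ u , f ⟫ + ⟪ u , g ⟫
  ⟪⟫-+ʳ u f g = trans (Σℕ-cong ν (λ t _ → *-distribˡ-+ (u t) (f t) (g t))) (Σℕ-+ ν _ _)

  ⟪⟫-*ʳ : ∀ u α f → ⟪ u , (λ t → α * f t) ⟫ ≡ α * ⟪ u , f ⟫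
  ⟪⟫-*ʳ u α f = trans (Σℕ-cong ν (λ t _ → solve 3 (λ u α f → u :* (α :* f) := α :* (u :* f)) refl (u t) α (f t)))
                      (Σℕ-*ˡ ν α _)

  mulLinear : ℕ → (ℕ → ℚ) → ℕ → ℚ
  mulLinear c u t = (ℕ→ℚ t - ℕ→ℚ c) * u t

  ⟪mulLinear⟫ : ∀ c u f → ⟪ mulLinear c u , f ⟫ ≡ ⟪ u , (λ t → (ℕ→ℚ t - ℕ→ℚ c) * f t) ⟫
  ⟪mulLinear⟫ c u f = Σℕ-cong ν (λ t _ → solve 3 (λ l u f → (l :* u) :* f := u :* (l :* f)) refl (ℕ→ℚ t - ℕ→ℚ c) (u t) (f t))

  ⟪mulLinear,bernstein⟫ : ∀ c u a b → ⟪ mulLinear c u , bernstein a b ⟫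
                                    ≡ ⟪ u , bernstein (suc a) b ⟫ + (ℕ→ℚ a - ℕ→ℚ c) * ⟪ u , bernstein a b ⟫
  ⟪mulLinear,bernstein⟫ c u a b = begin
    ⟪ mulLinear c u , bernstein a b ⟫
      ≡⟨ ⟪mulLinear⟫ c u (bernstein a b) ⟩
    ⟪ u , (λ t → (ℕ→ℚ t - ℕ→ℚ c) * bernstein a b t) ⟫
      ≡⟨ ⟪⟫-congʳ u (bernstein-shift a b c) ⟩
    ⟪ u , (λ t → bernstein (suc a) b t + (ℕ→ℚ a - ℕ→ℚ c) * bernstein a b t) ⟫
      ≡⟨ ⟪⟫-+ʳ u (bernstein (suc a) b) (λ t → (ℕ→ℚ a - ℕ→ℚ c) * bernstein a b t) ⟩
    ⟪ u , bernstein (suc a) b ⟫ + ⟪ u , (λ t → (ℕ→ℚ a - ℕ→ℚ c) * bernstein a b t) ⟫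
      ≡⟨ cong (⟪ u , bernstein (suc a) b ⟫ +_) (⟪⟫-*ʳ u (ℕ→ℚ a - ℕ→ℚ c) (bernstein a b)) ⟩
    ⟪ u , bernstein (suc a) b ⟫ + (ℕ→ℚ a - ℕ→ℚ c) * ⟪ u , bernstein a b ⟫ ∎

  ⟪,bernstein⟫-split : ∀ u a b → (ℕ→ℚ ν - ℕ→ℚ a - ℕ→ℚ b) * ⟪ u , bernstein a b ⟫
                                ≡ ⟪ u , bernstein a (suc b) ⟫ + ⟪ u , bernstein (suc a) b ⟫
  ⟪,bernstein⟫-split u a b = begin
    (ℕ→ℚ ν - ℕ→ℚ a - ℕ→ℚ b) * ⟪ u , bernstein a b ⟫
      ≡⟨ ⟪⟫-*ʳ u (ℕ→ℚ ν - ℕ→ℚ a - ℕ→ℚ b) (bernstein a b) ⟨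
    ⟪ u , (λ t → (ℕ→ℚ ν - ℕ→ℚ a - ℕ→ℚ b) * bernstein a b t) ⟫
      ≡⟨ ⟪⟫-congʳ u (bernstein-split a b) ⟩
    ⟪ u , (λ t → bernstein a (suc b) t + bernstein (suc a) b t) ⟫
      ≡⟨ ⟪⟫-+ʳ u (bernstein a (suc b)) (bernstein (suc a) b) ⟩
    ⟪ u , bernstein a (suc b) ⟫ + ⟪ u , bernstein (suc a) b ⟫ ∎

  -- u reproduces, in every degree up to K, the moments of the point mass C at ν,
  -- a point outside the range [0, ν) of the pairing.
  Moments : ℕ → (ℕ → ℚ) → ℚ → Set
  Moments K u C = ∀ a b → a ℕ.+ b ℕ.≤ K → ⟪ u , bernstein a b ⟫ ≡ C * bernstein a b ν

  MomentsOfDegree : ℕ → (ℕ → ℚ) → ℚ → Set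
  MomentsOfDegree n u C = ∀ a b → a ℕ.+ b ≡ n → ⟪ u , bernstein a b ⟫ ≡ C * bernstein a b ν

  moments-mulLinear : ∀ {K u C} c → Moments (suc K) u C → Moments K (mulLinear c u) ((ℕ→ℚ ν - ℕ→ℚ c) * C)
  moments-mulLinear {K} {u} {C} c M a b a+b≤K = begin
    ⟪ mulLinear c u , bernstein a b ⟫
      ≡⟨ ⟪mulLinear,bernstein⟫ c u a b ⟩
    ⟪ u , bernstein (suc a) b ⟫ + (ℕ→ℚ a - ℕ→ℚ c) * ⟪ u , bernstein a b ⟫
      ≡⟨ cong₂ (λ p q → p + (ℕ→ℚ a - ℕ→ℚ c) * q) (M (suc a) b (s≤s a+b≤K)) (M a b (ℕ.m≤n⇒m≤1+n a+b≤K)) ⟩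
    C * bernstein (suc a) b ν + (ℕ→ℚ a - ℕ→ℚ c) * (C * bernstein a b ν)
      ≡⟨ solve 4 (λ C p l q → C :* p :+ l :* (C :* q) := C :* (p :+ l :* q)) refl
           C (bernstein (suc a) b ν) (ℕ→ℚ a - ℕ→ℚ c) (bernstein a b ν) ⟩
    C * (bernstein (suc a) b ν + (ℕ→ℚ a - ℕ→ℚ c) * bernstein a b ν)
      ≡⟨ cong (C *_) (bernstein-shift a b c ν) ⟨
    C * ((ℕ→ℚ ν - ℕ→ℚ c) * bernstein a b ν)
      ≡⟨ solve 3 (λ C l q → C :* (l :* q) := (l :* C) :* q) refl C (ℕ→ℚ ν - ℕ→ℚ c) (bernstein a b ν) ⟩
    (ℕ→ℚ ν - ℕ→ℚ c) * C * bernstein a b ν ∎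

  0<ν-a-b : ∀ {a b} → a ℕ.+ b ℕ.< ν → 0ℚ < ℕ→ℚ ν - ℕ→ℚ a - ℕ→ℚ b
  0<ν-a-b {a} {b} a+b<ν = subst (0ℚ <_) ν-[a+b]≡ν-a-b (p<q⇒0<q-p (ℕ→ℚ-mono-< a+b<ν))
    where
    ν-[a+b]≡ν-a-b : ℕ→ℚ ν - ℕ→ℚ (a ℕ.+ b) ≡ ℕ→ℚ ν - ℕ→ℚ a - ℕ→ℚ b
    ν-[a+b]≡ν-a-b = trans (cong (λ x → ℕ→ℚ ν - x) (ℕ→ℚ-+ a b))
      (solve 3 (λ n a b → n :- (a :+ b) := n :- a :- b) refl (ℕ→ℚ ν) (ℕ→ℚ a) (ℕ→ℚ b))

  momentsOfDegree-pred : ∀ {n u C} → n ℕ.< ν → MomentsOfDegree (suc n) u C → MomentsOfDegree n u C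
  momentsOfDegree-pred {u = u} {C} a+b<ν M a b refl = *-cancelˡ-≡-pos ν-a-b (0<ν-a-b {a} {b} a+b<ν) (begin
    ν-a-b * ⟪ u , bernstein a b ⟫
      ≡⟨ ⟪,bernstein⟫-split u a b ⟩
    ⟪ u , bernstein a (suc b) ⟫ + ⟪ u , bernstein (suc a) b ⟫
      ≡⟨ cong₂ _+_ (M a (suc b) (ℕ.+-suc a b)) (M (suc a) b refl) ⟩
    C * bernstein a (suc b) ν + C * bernstein (suc a) b ν
      ≡⟨ *-distribˡ-+ C (bernstein a (suc b) ν) (bernstein (suc a) b ν) ⟨
    C * (bernstein a (suc b) ν + bernstein (suc a) b ν)
      ≡⟨ cong (C *_) (bernstein-split a b ν) ⟨
    C * (ν-a-b * bernstein a b ν)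
      ≡⟨ solve 3 (λ C l q → C :* (l :* q) := l :* (C :* q)) refl C ν-a-b (bernstein a b ν) ⟩
    ν-a-b * (C * bernstein a b ν) ∎)
    where
    ν-a-b = ℕ→ℚ ν - ℕ→ℚ a - ℕ→ℚ b

  moments-fromTop : ∀ {K u C} → K ℕ.< ν → MomentsOfDegree K u C → Moments K u C
  moments-fromTop {K} {u} {C} K<ν M a b a+b≤K = below (K ℕ.∸ (a ℕ.+ b)) (a ℕ.+ b) (ℕ.m+[n∸m]≡n a+b≤K) a b refl
    where
    below : ∀ i n → n ℕ.+ i ≡ K → MomentsOfDegree n u C
    below zero    n n+0≡K   = subst (λ m → MomentsOfDegree m u C) (sym (trans (sym (ℕ.+-identityʳ n)) n+0≡K)) M
    below (suc i) n n+1+i≡K = momentsOfDegree-pred {n} {u} {C} (ℕ.<-trans n<K K<ν) (below i (suc n) (trans (sym (ℕ.+-suc n i)) n+1+i≡K))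
      where
      n<K : n ℕ.< K
      n<K = subst (n ℕ.<_) n+1+i≡K (ℕ.m<m+n n ℕ.z<s)

  VanishesOff : List ℕ → (ℕ → ℚ) → Set
  VanishesOff l u = ∀ t → t ∉ l → u t ≡ 0ℚ

  ⟪⟫-point : ∀ {c u} f → c ℕ.< ν → VanishesOff (c ∷ []) u → ⟪ u , f ⟫ ≡ u c * f c
  ⟪⟫-point {c} {u} f c<ν u≡0 = Σℕ-point ν (λ t → u t * f t) c<ν
    (λ t t≢c → trans (cong (_* f t) (u≡0 t λ { (here t≡c) → t≢c t≡c })) (*-zeroˡ (f t)))

  mulLinear-vanishesOff : ∀ {l l′ c u} → VanishesOff l u → l ⊆ c ∷ l′ → VanishesOff l′ (mulLinear c u)
  mulLinear-vanishesOff {l} {l′} {c} {u} u≡0 l⊆c∷l′ t t∉l′ with t ℕ.≟ c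
  ... | yes refl = trans (cong (_* u t) (+-inverseʳ (ℕ→ℚ t))) (*-zeroˡ (u t))
  ... | no t≢c   = trans (cong ((ℕ→ℚ t - ℕ→ℚ c) *_) (u≡0 t t∉l)) (*-zeroʳ (ℕ→ℚ t - ℕ→ℚ c))
    where
    t∉l : t ∉ l
    t∉l t∈l with l⊆c∷l′ t∈l
    ... | here t≡c    = t≢c t≡c
    ... | there t∈l′ = t∉l′ t∈l′

  bernstein-0-0 : ∀ t → bernstein 0 0 t ≡ 1ℚ
  bernstein-0-0 t = *-identityˡ 1ℚ

  -- The induction multiplies u by (t - s) for the points s below c: this
  -- keeps the moment condition (one degree lower) and scales u c by c - s > 0.
  moments⇒head-pos : ∀ K {c rest u C} → All (ℕ._< c) rest → c ℕ.< ν → length rest ℕ.≤ K →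
                     VanishesOff (c ∷ rest) u → Moments K u C → 0ℚ < C → 0ℚ < u c
  moments⇒head-pos K {c} {[]} {u} {C} _ c<ν _ u≡0 M 0<C = subst (0ℚ <_) C≡uc 0<C
    where
    C≡uc : C ≡ u c
    C≡uc = begin
      C                      ≡⟨ trans (cong (C *_) (bernstein-0-0 ν)) (*-identityʳ C) ⟨
      C * bernstein 0 0 ν    ≡⟨ M 0 0 z≤n ⟨
      ⟪ u , bernstein 0 0 ⟫  ≡⟨ ⟪⟫-point (bernstein 0 0) c<ν u≡0 ⟩
      u c * bernstein 0 0 c  ≡⟨ trans (cong (u c *_) (bernstein-0-0 c)) (*-identityʳ (u c)) ⟩
      u c                    ∎
  moments⇒head-pos (suc K) {c} {s ∷ rest} {u} {C} (s<c ∷ rest<c) c<ν (s≤s len) u≡0 M 0<C =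
    sign-*-pos⁻¹ true (p<q⇒0<q-p (ℕ→ℚ-mono-< s<c))
      (moments⇒head-pos K rest<c c<ν len (mulLinear-vanishesOff u≡0 swap) (moments-mulLinear s M)
        (0<* (p<q⇒0<q-p (ℕ→ℚ-mono-< (ℕ.<-trans s<c c<ν))) 0<C))
    where
    swap : c ∷ s ∷ rest ⊆ s ∷ c ∷ rest
    swap (here t≡c)          = there (here t≡c)
    swap (there (here t≡s))  = here t≡s
    swap (there (there t∈r)) = there (there t∈r)

  Alternates : Bool → List ℕ → (ℕ → ℚ) → Set
  Alternates b []      u = ⊤
  Alternates b (t ∷ l) u = Sign b (u t) × Alternates (not b) l u

  alternates-mulLinear⁻¹ : ∀ {c u} b l → All (ℕ._< c) l → Alternates b l (mulLinear c u) → Alternates (not b) l u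
  alternates-mulLinear⁻¹ b []      _            _            = tt
  alternates-mulLinear⁻¹ b (t ∷ l) (t<c ∷ l<c) (sign , alt) =
    sign-*-neg⁻¹ b (p<q⇒p-q<0 (ℕ→ℚ-mono-< t<c)) sign , alternates-mulLinear⁻¹ (not b) l l<c alt

  moments⇒alternates : ∀ K {l u C} → AllPairs ℕ._>_ l → All (ℕ._< ν) l → length l ℕ.≤ suc K →
                       VanishesOff l u → Moments K u C → 0ℚ < C → Alternates true l u
  moments⇒alternates K       {[]}    _ _ _ _ _ _ = tt
  moments⇒alternates K       {c ∷ []} (c>[] ∷ _) (c<ν ∷ _) (s≤s len) u≡0 M 0<C =
    moments⇒head-pos K c>[] c<ν len u≡0 M 0<C , tt
  moments⇒alternates zero    {_ ∷ _ ∷ _} _ _ (s≤s ()) _ _ _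
  moments⇒alternates (suc K) {c ∷ l@(_ ∷ _)} (c>l ∷ l-sorted) (c<ν ∷ l<ν) (s≤s len) u≡0 M 0<C =
    moments⇒head-pos (suc K) c>l c<ν len u≡0 M 0<C ,
    alternates-mulLinear⁻¹ true l c>l
      (moments⇒alternates K l-sorted l<ν len (mulLinear-vanishesOff u≡0 (λ t∈ → t∈)) (moments-mulLinear c M)
        (0<* (p<q⇒0<q-p (ℕ→ℚ-mono-< c<ν)) 0<C))

  Annihilates : ℕ → (ℕ → ℚ) → Set
  Annihilates m u = ∀ a b → a ℕ.+ b ℕ.< m → ⟪ u , bernstein a b ⟫ ≡ 0ℚ

  annihilates-suc : ∀ {m u} c → ⟪ u , bernstein 0 0 ⟫ ≡ 0ℚ → Annihilates m (mulLinear c u) → Annihilates (suc m) u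
  annihilates-suc {m} {u} c mass≡0 ann a b (s≤s a+b≤m) = go a b a+b≤m
    where
    p+q≡0⇒q≡0⇒p≡0 : ∀ {p q} → p + q ≡ 0ℚ → q ≡ 0ℚ → p ≡ 0ℚ
    p+q≡0⇒q≡0⇒p≡0 {p} p+q≡0 refl = trans (sym (+-identityʳ p)) p+q≡0
    go : ∀ a b → a ℕ.+ b ℕ.≤ m → ⟪ u , bernstein a b ⟫ ≡ 0ℚ
    go zero    zero    _     = mass≡0
    go (suc a) b       a+b<m = p+q≡0⇒q≡0⇒p≡0
      (trans (sym (⟪mulLinear,bernstein⟫ c u a b)) (ann a b a+b<m))
      (trans (cong ((ℕ→ℚ a - ℕ→ℚ c) *_) (go a b (ℕ.<⇒≤ a+b<m))) (*-zeroʳ (ℕ→ℚ a - ℕ→ℚ c)))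
    go zero    (suc b) b<m   = p+q≡0⇒q≡0⇒p≡0
      (trans (sym (⟪,bernstein⟫-split u 0 b))
        (trans (cong ((ℕ→ℚ ν - ℕ→ℚ 0 - ℕ→ℚ b) *_) (go 0 b (ℕ.<⇒≤ b<m))) (*-zeroʳ (ℕ→ℚ ν - ℕ→ℚ 0 - ℕ→ℚ b))))
      (go 1 b b<m)

  pointMass : ℕ → ℚ → ℕ → ℚ
  pointMass c e t with t ℕ.≟ c
  ... | yes _ = e
  ... | no  _ = 0ℚ

  pointMass-≡ : ∀ c e → pointMass c e c ≡ e
  pointMass-≡ c e with c ℕ.≟ c
  ... | yes _   = refl
  ... | no c≢c = ⊥-elim (c≢c refl)

  pointMass-≢ : ∀ {c t} e → t ≢ c → pointMass c e t ≡ 0ℚ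
  pointMass-≢ {c} {t} e t≢c with t ℕ.≟ c
  ... | yes t≡c = ⊥-elim (t≢c t≡c)
  ... | no  _   = refl

  pointMass-vanishesOff : ∀ {c l} e → VanishesOff (c ∷ l) (pointMass c e)
  pointMass-vanishesOff e t t∉ = pointMass-≢ e (t∉ ∘ here)

  mulLinear-pointMass : ∀ c e t → mulLinear c (pointMass c e) t ≡ 0ℚ
  mulLinear-pointMass c e t with t ℕ.≟ c
  ... | yes refl = trans (cong (_* e) (+-inverseʳ (ℕ→ℚ t))) (*-zeroˡ e)
  ... | no  _    = *-zeroʳ (ℕ→ℚ t - ℕ→ℚ c)

  divLinear : ℕ → (ℕ → ℚ) → ℕ → ℚ
  divLinear c u t = u t * recip (ℕ→ℚ t - ℕ→ℚ c)

  mulLinear-divLinear : ∀ {c u} → u c ≡ 0ℚ → ∀ t → mulLinear c (divLinear c u) t ≡ u t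
  mulLinear-divLinear {c} {u} uc≡0 t with t ℕ.≟ c
  ... | yes refl = trans (cong (_* divLinear t u t) (+-inverseʳ (ℕ→ℚ t))) (trans (*-zeroˡ (divLinear t u t)) (sym uc≡0))
  ... | no  t≢c  = begin
    (ℕ→ℚ t - ℕ→ℚ c) * (u t * recip (ℕ→ℚ t - ℕ→ℚ c))
      ≡⟨ solve 3 (λ l u r → l :* (u :* r) := u :* (l :* r)) refl (ℕ→ℚ t - ℕ→ℚ c) (u t) (recip (ℕ→ℚ t - ℕ→ℚ c)) ⟩
    u t * ((ℕ→ℚ t - ℕ→ℚ c) * recip (ℕ→ℚ t - ℕ→ℚ c))
      ≡⟨ cong (u t *_) (*-recip (ℕ→ℚ-≢⇒-≢0 t≢c)) ⟩
    u t * 1ℚ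
      ≡⟨ *-identityʳ (u t) ⟩
    u t ∎

  -- Dividing by (t - c) and then adding the mass at c that cancels the total
  -- mass raises the annihilated degree by one.
  annihilator-step : ∀ {m c l} u′ → c ∉ l → c ℕ.< ν → VanishesOff l u′ → (∃[ i ] i ∈ l × u′ i ≢ 0ℚ) →
                     Annihilates m u′ →
                     Σ[ u ∈ (ℕ → ℚ) ] VanishesOff (c ∷ l) u × (∃[ i ] i ∈ c ∷ l × u i ≢ 0ℚ) × Annihilates (suc m) u
  annihilator-step {m} {c} {l} u′ c∉l c<ν u′≡0 (i , i∈l , u′i≢0) ann =
    u , u≡0 , (i , there i∈l , ui≢0) , annihilates-suc c mass≡0 ann′
    where
    v : ℕ → ℚ
    v = divLinear c u′
    e : ℚ
    e = - ⟪ v , bernstein 0 0 ⟫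
    u : ℕ → ℚ
    u t = v t + pointMass c e t
    mulLinear-u : ∀ t → mulLinear c u t ≡ u′ t
    mulLinear-u t = begin
      (ℕ→ℚ t - ℕ→ℚ c) * (v t + pointMass c e t)
        ≡⟨ *-distribˡ-+ (ℕ→ℚ t - ℕ→ℚ c) (v t) (pointMass c e t) ⟩
      mulLinear c v t + mulLinear c (pointMass c e) t
        ≡⟨ cong₂ _+_ (mulLinear-divLinear {c} {u′} (u′≡0 c c∉l) t) (mulLinear-pointMass c e t) ⟩
      u′ t + 0ℚ
        ≡⟨ +-identityʳ (u′ t) ⟩
      u′ t ∎
    mass≡0 : ⟪ u , bernstein 0 0 ⟫ ≡ 0ℚ
    mass≡0 = begin
      ⟪ u , bernstein 0 0 ⟫
        ≡⟨ ⟪⟫-+ˡ v (pointMass c e) (bernstein 0 0) ⟩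
      ⟪ v , bernstein 0 0 ⟫ + ⟪ pointMass c e , bernstein 0 0 ⟫
        ≡⟨ cong (⟪ v , bernstein 0 0 ⟫ +_) (⟪⟫-point (bernstein 0 0) c<ν (pointMass-vanishesOff e)) ⟩
      ⟪ v , bernstein 0 0 ⟫ + pointMass c e c * bernstein 0 0 c
        ≡⟨ cong (λ x → ⟪ v , bernstein 0 0 ⟫ + x * bernstein 0 0 c) (pointMass-≡ c e) ⟩
      ⟪ v , bernstein 0 0 ⟫ + e * bernstein 0 0 c
        ≡⟨ cong (λ x → ⟪ v , bernstein 0 0 ⟫ + e * x) (bernstein-0-0 c) ⟩
      ⟪ v , bernstein 0 0 ⟫ + e * 1ℚ
        ≡⟨ solve 1 (λ x → x :+ (:- x) :* con 1ℚ := con 0ℚ) refl ⟪ v , bernstein 0 0 ⟫ ⟩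
      0ℚ ∎
    ann′ : Annihilates m (mulLinear c u)
    ann′ a b a+b<m = trans (⟪⟫-congˡ (bernstein a b) (λ t _ → mulLinear-u t)) (ann a b a+b<m)
    u≡0 : VanishesOff (c ∷ l) u
    u≡0 t t∉ = begin
      u′ t * recip (ℕ→ℚ t - ℕ→ℚ c) + pointMass c e t
        ≡⟨ cong₂ (λ p q → p * recip (ℕ→ℚ t - ℕ→ℚ c) + q) (u′≡0 t (t∉ ∘ there)) (pointMass-vanishesOff e t t∉) ⟩
      0ℚ * recip (ℕ→ℚ t - ℕ→ℚ c) + 0ℚ
        ≡⟨ trans (+-identityʳ (0ℚ * recip (ℕ→ℚ t - ℕ→ℚ c))) (*-zeroˡ (recip (ℕ→ℚ t - ℕ→ℚ c))) ⟩
      0ℚ ∎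
    ui≢0 : u i ≢ 0ℚ
    ui≢0 ui≡0 = u′i≢0 (trans (sym (mulLinear-u i)) (trans (cong ((ℕ→ℚ i - ℕ→ℚ c) *_) ui≡0) (*-zeroʳ (ℕ→ℚ i - ℕ→ℚ c))))

  annihilator : ∀ m {l} → Unique l → All (ℕ._< ν) l → m ℕ.< length l →
                Σ[ u ∈ (ℕ → ℚ) ] VanishesOff l u × (∃[ i ] i ∈ l × u i ≢ 0ℚ) × Annihilates m u
  annihilator zero    {c ∷ l} _ (c<ν ∷ _) _ =
    pointMass c 1ℚ , pointMass-vanishesOff 1ℚ , (c , here refl , 1≢0 ∘ trans (sym (pointMass-≡ c 1ℚ))) , λ _ _ ()
  annihilator (suc m) {c ∷ l} (c∉l ∷ l-unique) (c<ν ∷ l<ν) (s≤s m<len)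
    with u′ , u′≡0 , u′≢0 , ann ← annihilator m l-unique l<ν m<len =
    annihilator-step u′ (All¬⇒¬Any c∉l) c<ν u′≡0 u′≢0 ann

module LinearProgram (ν d k : ℕ) (k<ν : k ℕ.< ν) (d<ν : d ℕ.< ν) (Y : Subset ν) (X : Subset (suc d)) where

  open import Data.Nat as ℕ using (ℕ; zero; suc; s≤s)
  import Data.Nat.Properties as ℕ
  open import Data.Nat.Combinatorics using (_C_; k>n⇒nCk≡0)
  open import Data.Fin as Fin using (Fin; toℕ)
  import Data.Fin.Properties as Fin
  open import Data.Fin.Subset using (_∈_; _∉_)
  open import Data.Fin.Subset.Properties using (_∈?_)
  open import Data.Rational
  open import Data.Rational.Properties
  open import Data.Rational.Solver using (module +-*-Solver)
  open import Data.Bool using (Bool; true; false; not; if_then_else_; _∧_; _∨_)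
  open import Data.Bool.Properties using (∨-zeroʳ)
  open import Data.Product as Product using (Σ-syntax; _×_; _,_; proj₁; proj₂)
  open import Data.List using (List; []; _∷_; length; map; _++_)
  open import Data.List.Relation.Unary.All as All using (All; []; _∷_)
  open import Data.List.Relation.Unary.AllPairs as AllPairs using (AllPairs; []; _∷_)
  open import Data.List.Relation.Unary.Any using (here; there)
  open import Data.List.Relation.Unary.Unique.Propositional using (Unique)
  open import Data.List.Membership.Propositional using () renaming (_∈_ to _∈ˡ_; _∉_ to _∉ˡ_)
  open import Relation.Nullary using (Dec; yes; no)
  open import Data.Empty using (⊥; ⊥-elim)
  open import Function using (_∘_)
  open import Function.Bundles using (_⇔_; mk⇔; Equivalence)
  open import Data.Unit using (tt)
  open import Relation.Binary.PropositionalEquality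
  open import Relation.Nullary.Reflects using (Reflects; ofʸ; ofⁿ)
  open FallingFactorial
  open RationalArithmetic
  open FiniteSums
  open SubsetMembership
  open Moments ν

  open +-*-Solver
  open ≡-Reasoning

  coefficient : ℕ → ℕ → ℚ
  coefficient h t = ℕ→ℚ (binomDiff (ν ℕ.∸ k) t h)

  -- The cut-off i ≤ ν - k + h in the y-coefficients is automatic for binomials.
  yCoef≡coefficient : ∀ h t → yCoef ν k h t ≡ coefficient h t
  yCoef≡coefficient h t =
    cut-off (h ℕ.≤ᵇ t) (ℕ.≤ᵇ-reflects-≤ h t) (t ℕ.≤ᵇ (ν ℕ.∸ k) ℕ.+ h) (ℕ.≤ᵇ-reflects-≤ t ((ν ℕ.∸ k) ℕ.+ h))
    where
    cut-off : ∀ b₁ → Reflects (h ℕ.≤ t) b₁ → ∀ b₂ → Reflects (t ℕ.≤ (ν ℕ.∸ k) ℕ.+ h) b₂ →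
              (if b₁ ∧ b₂ then coefficient h t else 0ℚ) ≡ coefficient h t
    cut-off true  _         true  _         = refl
    cut-off true  (ofʸ h≤t) false (ofⁿ t≰) =
      cong ℕ→ℚ (sym (trans (binomDiff-≤ (ν ℕ.∸ k) h≤t) (k>n⇒nCk≡0 ν-k<t-h)))
      where
      ν-k<t-h : ν ℕ.∸ k ℕ.< t ℕ.∸ h
      ν-k<t-h = ℕ.+-cancelʳ-< h (ν ℕ.∸ k) (t ℕ.∸ h) (subst ((ν ℕ.∸ k) ℕ.+ h ℕ.<_) (sym (ℕ.m∸n+n≡m h≤t)) (ℕ.≰⇒> t≰))
    cut-off false (ofⁿ h≰t) _     _         = cong ℕ→ℚ (sym (binomDiff-> (ν ℕ.∸ k) (ℕ.≰⇒> h≰t)))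

  lhs≡Σℕ : ∀ h y x → lhs ν d k h y x ≡ Σℕ[< ν ] (λ t → coefficient h t * (padZero x t - padZero y t))
  lhs≡Σℕ h y x = begin
    lhs ν d k h y x
      ≡⟨ cong₂ _-_ (Σ[<]≡Σℕ-padZero (xCoef ν k h) x d<ν) (Σ[<]≡Σℕ-padZero (yCoef ν k h) y ℕ.≤-refl) ⟩
    Σℕ[< ν ] (λ t → coefficient h t * padZero x t) - Σℕ[< ν ] (λ t → yCoef ν k h t * padZero y t)
      ≡⟨ Σℕ-- ν (λ t → coefficient h t * padZero x t) (λ t → yCoef ν k h t * padZero y t) ⟨
    Σℕ[< ν ] (λ t → coefficient h t * padZero x t - yCoef ν k h t * padZero y t)
      ≡⟨ Σℕ-cong ν (λ t _ → pointwise t) ⟩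
    Σℕ[< ν ] (λ t → coefficient h t * (padZero x t - padZero y t)) ∎
    where
    pointwise : ∀ t → coefficient h t * padZero x t - yCoef ν k h t * padZero y t
                    ≡ coefficient h t * (padZero x t - padZero y t)
    pointwise t = trans (cong (λ c → coefficient h t * padZero x t - c * padZero y t) (yCoef≡coefficient h t))
      (solve 3 (λ c a b → c :* a :- c :* b := c :* (a :- b)) refl (coefficient h t) (padZero x t) (padZero y t))

  weights : (Fin ν → ℚ) → (Fin (suc d) → ℚ) → ℕ → ℚ
  weights y x t = ℕ→ℚ (ν C t) * (padZero x t - padZero y t)

  coefficient*ν↓k : ∀ {h t} → h ℕ.≤ k → t ℕ.≤ ν →
                    coefficient h t * ℕ→ℚ (ν ↓ k) ≡ ℕ→ℚ (ν C t) * bernstein h (k ℕ.∸ h) t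
  coefficient*ν↓k {h} {t} h≤k t≤ν = begin
    coefficient h t * ℕ→ℚ (ν ↓ k)
      ≡⟨ ℕ→ℚ-* (binomDiff (ν ℕ.∸ k) t h) (ν ↓ k) ⟨
    ℕ→ℚ (binomDiff (ν ℕ.∸ k) t h ℕ.* ν ↓ k)
      ≡⟨ cong ℕ→ℚ (binomDiff*↓≡C*[↓*↓] (ℕ.<⇒≤ k<ν) t≤ν h≤k) ⟩
    ℕ→ℚ ((ν C t) ℕ.* (t ↓ h ℕ.* (ν ℕ.∸ t) ↓ (k ℕ.∸ h)))
      ≡⟨ trans (ℕ→ℚ-* (ν C t) _) (cong (ℕ→ℚ (ν C t) *_) (ℕ→ℚ-* (t ↓ h) ((ν ℕ.∸ t) ↓ (k ℕ.∸ h)))) ⟩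
    ℕ→ℚ (ν C t) * (ℕ→ℚ (t ↓ h) * ℕ→ℚ ((ν ℕ.∸ t) ↓ (k ℕ.∸ h)))
      ≡⟨ cong₂ (λ p q → ℕ→ℚ (ν C t) * (p * q)) (ℕ→ℚ-↓ t h) (ℕ→ℚ-↓ (ν ℕ.∸ t) (k ℕ.∸ h)) ⟨
    ℕ→ℚ (ν C t) * (ℕ→ℚ t ↓ℚ h * ℕ→ℚ (ν ℕ.∸ t) ↓ℚ (k ℕ.∸ h))
      ≡⟨ cong (λ p → ℕ→ℚ (ν C t) * (ℕ→ℚ t ↓ℚ h * p ↓ℚ (k ℕ.∸ h))) (ℕ→ℚ-∸ t≤ν) ⟩
    ℕ→ℚ (ν C t) * bernstein h (k ℕ.∸ h) t ∎

  ν↓k*lhs≡⟪weights⟫ : ∀ {h} y x → h ℕ.≤ k → ℕ→ℚ (ν ↓ k) * lhs ν d k h y x ≡ ⟪ weights y x , bernstein h (k ℕ.∸ h) ⟫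
  ν↓k*lhs≡⟪weights⟫ {h} y x h≤k = begin
    ℕ→ℚ (ν ↓ k) * lhs ν d k h y x
      ≡⟨ cong (ℕ→ℚ (ν ↓ k) *_) (lhs≡Σℕ h y x) ⟩
    ℕ→ℚ (ν ↓ k) * Σℕ[< ν ] (λ t → coefficient h t * (padZero x t - padZero y t))
      ≡⟨ Σℕ-*ˡ ν (ℕ→ℚ (ν ↓ k)) (λ t → coefficient h t * (padZero x t - padZero y t)) ⟨
    Σℕ[< ν ] (λ t → ℕ→ℚ (ν ↓ k) * (coefficient h t * (padZero x t - padZero y t)))
      ≡⟨ Σℕ-cong ν (λ t t<ν → pointwise t (ℕ.<⇒≤ t<ν)) ⟩
    ⟪ weights y x , bernstein h (k ℕ.∸ h) ⟫ ∎
    where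
    pointwise : ∀ t → t ℕ.≤ ν → ℕ→ℚ (ν ↓ k) * (coefficient h t * (padZero x t - padZero y t))
                              ≡ weights y x t * bernstein h (k ℕ.∸ h) t
    pointwise t t≤ν = begin
      ℕ→ℚ (ν ↓ k) * (coefficient h t * (padZero x t - padZero y t))
        ≡⟨ solve 3 (λ f c z → f :* (c :* z) := (c :* f) :* z) refl (ℕ→ℚ (ν ↓ k)) (coefficient h t) (padZero x t - padZero y t) ⟩
      coefficient h t * ℕ→ℚ (ν ↓ k) * (padZero x t - padZero y t)
        ≡⟨ cong (_* (padZero x t - padZero y t)) (coefficient*ν↓k h≤k t≤ν) ⟩
      ℕ→ℚ (ν C t) * bernstein h (k ℕ.∸ h) t * (padZero x t - padZero y t)
        ≡⟨ solve 3 (λ c b z → (c :* b) :* z := (c :* z) :* b) refl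
             (ℕ→ℚ (ν C t)) (bernstein h (k ℕ.∸ h) t) (padZero x t - padZero y t) ⟩
      weights y x t * bernstein h (k ℕ.∸ h) t ∎

  0<ν↓k : 0ℚ < ℕ→ℚ (ν ↓ k)
  0<ν↓k = 0<ℕ→ℚ (0<m↓a (ℕ.<⇒≤ k<ν))

  lhs≡0 : ∀ y x → (∀ h → h ℕ.≤ k → ⟪ weights y x , bernstein h (k ℕ.∸ h) ⟫ ≡ 0ℚ) →
          ∀ (h : Fin (suc k)) → lhs ν d k (toℕ h) y x ≡ 0ℚ
  lhs≡0 y x ⟪weights⟫≡0 h = *-cancelˡ-≡-pos (ℕ→ℚ (ν ↓ k)) 0<ν↓k (begin
    ℕ→ℚ (ν ↓ k) * lhs ν d k (toℕ h) y x               ≡⟨ ν↓k*lhs≡⟪weights⟫ y x h≤k ⟩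
    ⟪ weights y x , bernstein (toℕ h) (k ℕ.∸ toℕ h) ⟫ ≡⟨ ⟪weights⟫≡0 (toℕ h) h≤k ⟩
    0ℚ                                                ≡⟨ *-zeroʳ (ℕ→ℚ (ν ↓ k)) ⟨
    ℕ→ℚ (ν ↓ k) * 0ℚ                                  ∎)
    where
    h≤k : toℕ h ℕ.≤ k
    h≤k = ℕ.≤-pred (Fin.toℕ<n h)

  rhs-≡ : rhs k k ≡ 1ℚ
  rhs-≡ with k ℕ.≤ᵇ k | ℕ.≤⇒≤ᵇ (ℕ.≤-refl {k})
  ... | true | _ = refl

  rhs-< : ∀ {a} → a ℕ.< k → rhs k a ≡ 0ℚ
  rhs-< {a} a<k with k ℕ.≤ᵇ a | ℕ.≤ᵇ-reflects-≤ k a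
  ... | true  | ofʸ k≤a = ⊥-elim (ℕ.<⇒≱ a<k k≤a)
  ... | false | _       = refl

  ν↓k*rhs≡bernstein : ∀ a b → a ℕ.+ b ≡ k → ℕ→ℚ (ν ↓ k) * rhs k a ≡ 1ℚ * bernstein a b ν
  ν↓k*rhs≡bernstein a zero a+0≡k rewrite ℕ.+-identityʳ a | a+0≡k = begin
    ℕ→ℚ (ν ↓ k) * rhs k k ≡⟨ cong (ℕ→ℚ (ν ↓ k) *_) rhs-≡ ⟩
    ℕ→ℚ (ν ↓ k) * 1ℚ      ≡⟨ cong (_* 1ℚ) (ℕ→ℚ-↓ ν k) ⟨
    ℕ→ℚ ν ↓ℚ k * 1ℚ       ≡⟨ *-identityˡ (bernstein k 0 ν) ⟨
    1ℚ * bernstein k 0 ν  ∎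
  ν↓k*rhs≡bernstein a (suc b) a+b+1≡k = begin
    ℕ→ℚ (ν ↓ k) * rhs k a                       ≡⟨ cong (ℕ→ℚ (ν ↓ k) *_) (rhs-< a<k) ⟩
    ℕ→ℚ (ν ↓ k) * 0ℚ                            ≡⟨ *-zeroʳ (ℕ→ℚ (ν ↓ k)) ⟩
    0ℚ                                          ≡⟨ *-zeroʳ (1ℚ * ℕ→ℚ ν ↓ℚ a) ⟨
    1ℚ * ℕ→ℚ ν ↓ℚ a * 0ℚ                        ≡⟨ cong (λ p → 1ℚ * ℕ→ℚ ν ↓ℚ a * p) (0ℚ↓ℚsuc b) ⟨
    1ℚ * ℕ→ℚ ν ↓ℚ a * 0ℚ ↓ℚ suc b               ≡⟨ cong (λ p → 1ℚ * ℕ→ℚ ν ↓ℚ a * p ↓ℚ suc b) (+-inverseʳ (ℕ→ℚ ν)) ⟨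
    1ℚ * ℕ→ℚ ν ↓ℚ a * (ℕ→ℚ ν - ℕ→ℚ ν) ↓ℚ suc b ≡⟨ *-assoc 1ℚ (ℕ→ℚ ν ↓ℚ a) _ ⟩
    1ℚ * bernstein a (suc b) ν                  ∎
    where
    a<k : a ℕ.< k
    a<k = subst (a ℕ.<_) a+b+1≡k (ℕ.m<m+n a ℕ.z<s)

  basicSolution⇒moments : ∀ {y x} → IsBasicSolution ν d k Y X y x → Moments k (weights y x) 1ℚ
  basicSolution⇒moments {y} {x} (_ , solves) = moments-fromTop {k} {weights y x} {1ℚ} k<ν top
    where
    top : MomentsOfDegree k (weights y x) 1ℚ
    top a b a+b≡k = begin
      ⟪ weights y x , bernstein a b ⟫         ≡⟨ cong (λ b → ⟪ weights y x , bernstein a b ⟫) b≡k∸a ⟩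
      ⟪ weights y x , bernstein a (k ℕ.∸ a) ⟫ ≡⟨ ν↓k*lhs≡⟪weights⟫ y x a≤k ⟨
      ℕ→ℚ (ν ↓ k) * lhs ν d k a y x           ≡⟨ cong (ℕ→ℚ (ν ↓ k) *_) lhs≡rhs ⟩
      ℕ→ℚ (ν ↓ k) * rhs k a                   ≡⟨ ν↓k*rhs≡bernstein a b a+b≡k ⟩
      1ℚ * bernstein a b ν                    ∎
      where
      a≤k : a ℕ.≤ k
      a≤k = subst (a ℕ.≤_) a+b≡k (ℕ.m≤m+n a b)
      b≡k∸a : b ≡ k ℕ.∸ a
      b≡k∸a = sym (trans (cong (ℕ._∸ a) (sym a+b≡k)) (ℕ.m+n∸m≡n a b))
      lhs≡rhs : lhs ν d k a y x ≡ rhs k a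
      lhs≡rhs = subst (λ i → lhs ν d k i y x ≡ rhs k i) (Fin.toℕ-fromℕ< (s≤s a≤k)) (solves (Fin.fromℕ< (s≤s a≤k)))

  InXY : ℕ → Bool
  InXY j = memℕ X j ∨ memℕ Y j

  support : ℕ → List ℕ
  support zero    = []
  support (suc n) = if InXY n then n ∷ support n else support n

  support-bounded : ∀ n → All (ℕ._< n) (support n)
  support-bounded zero = []
  support-bounded (suc n) with InXY n
  ... | true  = ℕ.≤-refl ∷ All.map ℕ.m<n⇒m<1+n (support-bounded n)
  ... | false = All.map ℕ.m<n⇒m<1+n (support-bounded n)

  support-sorted : ∀ n → AllPairs ℕ._>_ (support n)
  support-sorted zero = []
  support-sorted (suc n) with InXY n
  ... | true  = support-bounded n ∷ support-sorted n
  ... | false = support-sorted n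

  support-unique : ∀ n → Unique (support n)
  support-unique n = AllPairs.map (λ i>j i≡j → ℕ.<-irrefl (sym i≡j) i>j) (support-sorted n)

  ∈-support⁻ : ∀ {n j} → j ∈ˡ support n → j ℕ.< n × InXY j ≡ true
  ∈-support⁻ {suc n} {j} j∈ with InXY n in inXY
  ∈-support⁻ {suc n} (here refl) | true = ℕ.≤-refl , inXY
  ∈-support⁻ {suc n} (there j∈)  | true = Product.map₁ ℕ.m<n⇒m<1+n (∈-support⁻ j∈)
  ∈-support⁻ {suc n} j∈          | false = Product.map₁ ℕ.m<n⇒m<1+n (∈-support⁻ j∈)

  ∈-support⁺ : ∀ {n j} → j ℕ.< n → InXY j ≡ true → j ∈ˡ support n
  ∈-support⁺ {suc n} {j} j<1+n inXY with j ℕ.≟ n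
  ... | yes refl rewrite inXY = here refl
  ... | no j≢n with InXY n
  ...   | true  = there (∈-support⁺ (ℕ.≤∧≢⇒< (ℕ.≤-pred j<1+n) j≢n) inXY)
  ...   | false = ∈-support⁺ (ℕ.≤∧≢⇒< (ℕ.≤-pred j<1+n) j≢n) inXY

  private
    true≢false : true ≢ false
    true≢false ()

    ≢true⇒≡false : ∀ {b} → b ≢ true → b ≡ false
    ≢true⇒≡false {true}  b≢true = ⊥-elim (b≢true refl)
    ≢true⇒≡false {false} _      = refl

    ∨≡false : ∀ a b → a ∨ b ≡ false → a ≡ false × b ≡ false
    ∨≡false false false _ = refl , refl

  ∉-support : ∀ {t} → t ∉ˡ support ν → memℕ X t ≡ false × memℕ Y t ≡ false
  ∉-support {t} t∉ with t ℕ.<? ν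
  ... | no t≮ν = memℕ-≥ X t (ℕ.≤-trans d<ν (ℕ.≮⇒≥ t≮ν)) , memℕ-≥ Y t (ℕ.≮⇒≥ t≮ν)
  ... | yes t<ν with InXY t in inXY
  ...   | true  = ⊥-elim (t∉ (∈-support⁺ t<ν inXY))
  ...   | false = ∨≡false (memℕ X t) (memℕ Y t) inXY

  weights-vanishesOff : ∀ {y x} → SupportedOn Y X y x → VanishesOff (support ν) (weights y x)
  weights-vanishesOff {y} {x} (y-supp , x-supp) t t∉ = begin
    ℕ→ℚ (ν C t) * (padZero x t - padZero y t)
      ≡⟨ cong₂ (λ p q → ℕ→ℚ (ν C t) * (p - q)) (padZero-vanishes X x x-supp t X∌t) (padZero-vanishes Y y y-supp t Y∌t) ⟩
    ℕ→ℚ (ν C t) * (0ℚ - 0ℚ)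
      ≡⟨ *-zeroʳ (ℕ→ℚ (ν C t)) ⟩
    0ℚ ∎
    where
    X∌t = proj₁ (∉-support t∉)
    Y∌t = proj₂ (∉-support t∉)

  independent⇒¬both : ColumnsIndependent ν d k Y X → ∀ {j} → memℕ X j ≡ true → memℕ Y j ≡ true → ⊥
  independent⇒¬both indep {j} X∋j Y∋j = 1≢0 (begin
    1ℚ                   ≡⟨ pointMass-≡ j 1ℚ ⟨
    δ j                  ≡⟨ cong δ (Fin.toℕ-fromℕ< j<1+d) ⟨
    x (Fin.fromℕ< j<1+d) ≡⟨ x≡0 (Fin.fromℕ< j<1+d) ⟩
    0ℚ                   ∎)
    where
    δ : ℕ → ℚ
    δ = pointMass j 1ℚ
    x : Fin (suc d) → ℚ
    x = δ ∘ toℕ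
    y : Fin ν → ℚ
    y = δ ∘ toℕ
    j<1+d : j ℕ.< suc d
    j<1+d = memℕ⇒< X j X∋j
    indicator : ∀ {n} (S : Subset n) → memℕ S j ≡ true →
                (∀ i → i ∉ S → δ (toℕ i) ≡ 0ℚ) × (∀ t → padZero {n} (δ ∘ toℕ) t ≡ δ t)
    indicator {n} S S∋j = (λ i i∉S → pointMass-≢ 1ℚ (λ i≡j → i∉S (memℕ⇒∈ S i (trans (cong (memℕ S) i≡j) S∋j)))) ,
      padZero-∘toℕ δ (λ t n≤t → pointMass-≢ 1ℚ (λ t≡j → ℕ.<⇒≱ (memℕ⇒< S j S∋j) (subst (n ℕ.≤_) t≡j n≤t)))
    x-supp = proj₁ (indicator X X∋j)
    y-supp = proj₁ (indicator Y Y∋j)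
    weights≡0 : ∀ t → t ℕ.< ν → weights y x t ≡ 0ℚ
    weights≡0 t _ = begin
      ℕ→ℚ (ν C t) * (padZero x t - padZero y t)
        ≡⟨ cong₂ (λ p q → ℕ→ℚ (ν C t) * (p - q)) (proj₂ (indicator X X∋j) t) (proj₂ (indicator Y Y∋j) t) ⟩
      ℕ→ℚ (ν C t) * (δ t - δ t) ≡⟨ cong (ℕ→ℚ (ν C t) *_) (+-inverseʳ (δ t)) ⟩
      ℕ→ℚ (ν C t) * 0ℚ          ≡⟨ *-zeroʳ (ℕ→ℚ (ν C t)) ⟩
      0ℚ                        ∎
    x≡0 : ∀ i → x i ≡ 0ℚ
    x≡0 = proj₂ (indep y x (y-supp , x-supp) (lhs≡0 y x λ h _ → ⟪⟫-zeroˡ (bernstein h (k ℕ.∸ h)) weights≡0))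

  Disjoint : Set
  Disjoint = ∀ {j} → memℕ X j ≡ true → memℕ Y j ≡ false

  independent⇒disjoint : ColumnsIndependent ν d k Y X → Disjoint
  independent⇒disjoint indep X∋j = ≢true⇒≡false (independent⇒¬both indep X∋j)

  private
    xyParts : Bool → Bool → ℚ → ℚ × ℚ
    xyParts true  _     q = q , 0ℚ
    xyParts false true  q = 0ℚ , - q
    xyParts false false q = 0ℚ , 0ℚ

    xyParts-x : ∀ b₁ b₂ q → b₁ ≡ false → proj₁ (xyParts b₁ b₂ q) ≡ 0ℚ
    xyParts-x false true  q _ = refl
    xyParts-x false false q _ = refl

    xyParts-y : ∀ b₁ b₂ q → b₂ ≡ false → proj₂ (xyParts b₁ b₂ q) ≡ 0ℚ
    xyParts-y true  false q _ = refl
    xyParts-y false false q _ = refl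

    xyParts-diff : ∀ b₁ b₂ q → (b₁ ∨ b₂ ≡ false → q ≡ 0ℚ) → proj₁ (xyParts b₁ b₂ q) - proj₂ (xyParts b₁ b₂ q) ≡ q
    xyParts-diff true  _     q _    = solve 1 (λ q → q :- con 0ℚ := q) refl q
    xyParts-diff false true  q _    = solve 1 (λ q → con 0ℚ :- (:- q) := q) refl q
    xyParts-diff false false q q≡0 = sym (q≡0 refl)

  weights-onto : ∀ u → VanishesOff (support ν) u →
                 Σ[ y ∈ (Fin ν → ℚ) ] Σ[ x ∈ (Fin (suc d) → ℚ) ] SupportedOn Y X y x × (∀ t → t ℕ.< ν → weights y x t ≡ u t)
  weights-onto u u≡0 = y , x , (y-supp , x-supp) , weights≡u
    where
    z : ℕ → ℚ
    z t = u t * recip (ℕ→ℚ (ν C t))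
    parts : ℕ → ℚ × ℚ
    parts t = xyParts (memℕ X t) (memℕ Y t) (z t)
    x : Fin (suc d) → ℚ
    x = proj₁ ∘ parts ∘ toℕ
    y : Fin ν → ℚ
    y = proj₂ ∘ parts ∘ toℕ
    x-supp : ∀ i → i ∉ X → x i ≡ 0ℚ
    x-supp i i∉X = xyParts-x (memℕ X (toℕ i)) (memℕ Y (toℕ i)) (z (toℕ i)) (∉⇒memℕ X i i∉X)
    y-supp : ∀ i → i ∉ Y → y i ≡ 0ℚ
    y-supp i i∉Y = xyParts-y (memℕ X (toℕ i)) (memℕ Y (toℕ i)) (z (toℕ i)) (∉⇒memℕ Y i i∉Y)
    z≡0 : ∀ t → InXY t ≡ false → z t ≡ 0ℚ
    z≡0 t outside = trans (cong (_* recip (ℕ→ℚ (ν C t))) (u≡0 t t∉)) (*-zeroˡ (recip (ℕ→ℚ (ν C t))))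
      where
      t∉ : t ∉ˡ support ν
      t∉ t∈ = true≢false (trans (sym (proj₂ (∈-support⁻ {ν} t∈))) outside)
    padZero-x-y : ∀ t → padZero x t - padZero y t ≡ z t
    padZero-x-y t = begin
      padZero x t - padZero y t
        ≡⟨ cong₂ _-_ (padZero-∘toℕ (proj₁ ∘ parts) (λ t 1+d≤t → xyParts-x (memℕ X t) (memℕ Y t) (z t) (memℕ-≥ X t 1+d≤t)) t)
                     (padZero-∘toℕ (proj₂ ∘ parts) (λ t ν≤t → xyParts-y (memℕ X t) (memℕ Y t) (z t) (memℕ-≥ Y t ν≤t)) t) ⟩
      proj₁ (parts t) - proj₂ (parts t)
        ≡⟨ xyParts-diff (memℕ X t) (memℕ Y t) (z t) (z≡0 t) ⟩
      z t ∎
    weights≡u : ∀ t → t ℕ.< ν → weights y x t ≡ u t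
    weights≡u t t<ν = begin
      ℕ→ℚ (ν C t) * (padZero x t - padZero y t)  ≡⟨ cong (ℕ→ℚ (ν C t) *_) (padZero-x-y t) ⟩
      ℕ→ℚ (ν C t) * (u t * recip (ℕ→ℚ (ν C t)))
        ≡⟨ solve 3 (λ c u r → c :* (u :* r) := u :* (c :* r)) refl (ℕ→ℚ (ν C t)) (u t) (recip (ℕ→ℚ (ν C t))) ⟩
      u t * (ℕ→ℚ (ν C t) * recip (ℕ→ℚ (ν C t)))
        ≡⟨ cong (u t *_) (*-recip (λ C≡0 → <-irrefl (sym C≡0) (0<ℕ→ℚ (0<nCk (ℕ.<⇒≤ t<ν))))) ⟩
      u t * 1ℚ                                   ≡⟨ *-identityʳ (u t) ⟩
      u t                                        ∎

  independent⇒annihilated≡0 : ColumnsIndependent ν d k Y X → ∀ {u} → VanishesOff (support ν) u →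
                               Annihilates (suc k) u → ∀ t → t ℕ.< ν → u t ≡ 0ℚ
  independent⇒annihilated≡0 indep {u} u≡0 ann t t<ν = begin
    u t
      ≡⟨ weights≡u t t<ν ⟨
    ℕ→ℚ (ν C t) * (padZero x t - padZero y t)
      ≡⟨ cong₂ (λ p q → ℕ→ℚ (ν C t) * (p - q)) (padZero-≡0 x x≡0 t) (padZero-≡0 y y≡0 t) ⟩
    ℕ→ℚ (ν C t) * (0ℚ - 0ℚ)
      ≡⟨ *-zeroʳ (ℕ→ℚ (ν C t)) ⟩
    0ℚ ∎
    where
    onto = weights-onto u u≡0
    y = proj₁ onto
    x = proj₁ (proj₂ onto)
    supported = proj₁ (proj₂ (proj₂ onto))
    weights≡u = proj₂ (proj₂ (proj₂ onto))
    ⟪weights⟫≡0 : ∀ h → h ℕ.≤ k → ⟪ weights y x , bernstein h (k ℕ.∸ h) ⟫ ≡ 0ℚ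
    ⟪weights⟫≡0 h h≤k = trans (⟪⟫-congˡ (bernstein h (k ℕ.∸ h)) weights≡u)
                              (ann h (k ℕ.∸ h) (s≤s (ℕ.≤-reflexive (ℕ.m+[n∸m]≡n h≤k))))
    zero-solution = indep y x supported (lhs≡0 y x ⟪weights⟫≡0)
    y≡0 = proj₁ zero-solution
    x≡0 = proj₂ zero-solution

  independent⇒support-length : ColumnsIndependent ν d k Y X → length (support ν) ℕ.≤ suc k
  independent⇒support-length indep = ℕ.≮⇒≥ λ 1+k<length →
    let (u , u≡0 , (i , i∈ , ui≢0) , ann) = annihilator (suc k) (support-unique ν) (support-bounded ν) 1+k<length
    in ui≢0 (independent⇒annihilated≡0 indep u≡0 ann i (proj₁ (∈-support⁻ i∈)))

  basicSolution⇒alternates : ColumnsIndependent ν d k Y X → ∀ {y x} → IsBasicSolution ν d k Y X y x →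
                             Alternates true (support ν) (weights y x)
  basicSolution⇒alternates indep solution@(supported , _) =
    moments⇒alternates k (support-sorted ν) (support-bounded ν) (independent⇒support-length indep)
      (weights-vanishesOff supported) (basicSolution⇒moments solution) (positive⁻¹ 1ℚ)

  weights-weakSign : Disjoint → ∀ {y x} → SupportedOn Y X y x →
                     (∀ i → 0ℚ ≤ y i) → (∀ i → 0ℚ ≤ x i) → ∀ s → WeakSign (memℕ X s) (weights y x s)
  weights-weakSign disjoint {y} {x} (y-supp , x-supp) 0≤y 0≤x s =
    weakSign-*-nonneg (memℕ X s) (0≤ℕ→ℚ (ν C s)) (difference (memℕ X s) refl)
    where
    difference : ∀ b → memℕ X s ≡ b → WeakSign b (padZero x s - padZero y s)
    difference true  X∋s = subst (λ q → 0ℚ ≤ padZero x s - q) (sym (padZero-vanishes Y y y-supp s (disjoint X∋s)))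
                             (subst (0ℚ ≤_) (sym (+-identityʳ (padZero x s))) (padZero-nonneg x 0≤x s))
    difference false X∌s = subst (λ p → p - padZero y s ≤ 0ℚ) (sym (padZero-vanishes X x x-supp s X∌s))
                             (subst (_≤ 0ℚ) (sym (+-identityˡ (- padZero y s))) (neg-antimono-≤ (padZero-nonneg y 0≤y s)))

  weights-weakSign⁻¹ : Disjoint → ∀ {y x} → SupportedOn Y X y x →
                       (∀ s → s ∈ˡ support ν → WeakSign (memℕ X s) (weights y x s)) →
                       (∀ i → 0ℚ ≤ y i) × (∀ i → 0ℚ ≤ x i)
  weights-weakSign⁻¹ disjoint {y} {x} (y-supp , x-supp) weakSign = (λ i → 0≤y i (i ∈? Y)) , (λ i → 0≤x i (i ∈? X))
    where
    difference-weakSign : ∀ {s b} → s ℕ.< ν → InXY s ≡ true → memℕ X s ≡ b → WeakSign b (padZero x s - padZero y s)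
    difference-weakSign {s} s<ν inXY refl =
      weakSign-*-pos⁻¹ (memℕ X s) (0<ℕ→ℚ (0<nCk (ℕ.<⇒≤ s<ν))) (weakSign s (∈-support⁺ s<ν inXY))
    0≤x : ∀ i → Dec (i ∈ X) → 0ℚ ≤ x i
    0≤x i (no i∉X)  = ≤-reflexive (sym (x-supp i i∉X))
    0≤x i (yes i∈X) = subst (0ℚ ≤_) x-y≡x (difference-weakSign s<ν (cong (_∨ memℕ Y s) X∋s) X∋s)
      where
      s = toℕ i
      X∋s : memℕ X s ≡ true
      X∋s = ∈⇒memℕ X i i∈X
      s<ν : s ℕ.< ν
      s<ν = ℕ.<-≤-trans (Fin.toℕ<n i) d<ν
      x-y≡x : padZero x s - padZero y s ≡ x i
      x-y≡x = trans (cong₂ _-_ (padZero-toℕ x i) (padZero-vanishes Y y y-supp s (disjoint X∋s)))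
                    (+-identityʳ (x i))
    0≤y : ∀ i → Dec (i ∈ Y) → 0ℚ ≤ y i
    0≤y i (no i∉Y)  = ≤-reflexive (sym (y-supp i i∉Y))
    0≤y i (yes i∈Y) = subst (0ℚ ≤_) (solve 1 (λ p → :- (:- p) := p) refl (y i)) (neg-antimono-≤ -y≤0)
      where
      s = toℕ i
      Y∋s : memℕ Y s ≡ true
      Y∋s = ∈⇒memℕ Y i i∈Y
      X∌s : memℕ X s ≡ false
      X∌s = ≢true⇒≡false (λ X∋s → true≢false (trans (sym Y∋s) (disjoint X∋s)))
      x-y≡-y : padZero x s - padZero y s ≡ - y i
      x-y≡-y = trans (cong₂ _-_ (padZero-vanishes X x x-supp s X∌s) (padZero-toℕ y i)) (+-identityˡ (- y i))
      -y≤0 : - y i ≤ 0ℚ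
      -y≤0 = subst (_≤ 0ℚ) x-y≡-y
               (difference-weakSign (Fin.toℕ<n i) (trans (cong (memℕ X s ∨_) Y∋s) (∨-zeroʳ (memℕ X s))) X∌s)

  tagOf : Bool → Tag
  tagOf true  = tX
  tagOf false = tY

  tagOf-injective : ∀ {b c} → tagOf b ≡ tagOf c → b ≡ c
  tagOf-injective {true}  {true}  _ = refl
  tagOf-injective {false} {false} _ = refl

  other-tagOf : ∀ b → other (tagOf b) ≡ tagOf (not b)
  other-tagOf true  = refl
  other-tagOf false = refl

  tag : ℕ → Tag
  tag s = tagOf (memℕ X s)

  tagsBelow≡map-tag : Disjoint → ∀ n → tagsBelow Y X n ≡ map tag (support n)
  tagsBelow≡map-tag disjoint zero    = refl
  tagsBelow≡map-tag disjoint (suc n) = step (memℕ X n) (memℕ Y n) refl refl (tagsBelow≡map-tag disjoint n)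
    where
    step : ∀ b₁ b₂ {ts l} → memℕ X n ≡ b₁ → memℕ Y n ≡ b₂ → ts ≡ map tag l →
           ((if b₁ then tX ∷ [] else []) ++ (if b₂ then tY ∷ [] else [])) ++ ts ≡ map tag (if b₁ ∨ b₂ then n ∷ l else l)
    step true  true  X∋n Y∋n _     = ⊥-elim (true≢false (trans (sym Y∋n) (disjoint X∋n)))
    step true  false X∋n _   ts≡ = cong₂ _∷_ (cong tagOf (sym X∋n)) ts≡
    step false true  X∌n _   ts≡ = cong₂ _∷_ (cong tagOf (sym X∌n)) ts≡
    step false false _   _   ts≡ = ts≡

  alternates⇒tags⇔weakSigns : ∀ {u} b l → Alternates b l u →
                              AlternatesFrom (tagOf b) (map tag l) ⇔ All (λ s → WeakSign (memℕ X s) (u s)) l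
  alternates⇒tags⇔weakSigns b []      _             = mk⇔ (λ _ → []) (λ _ → tt)
  alternates⇒tags⇔weakSigns b (s ∷ l) (sign , alt) = mk⇔
    (λ (tag≡ , tags) → Equivalence.from weakSign⇔ (tagOf-injective tag≡)
                         ∷ Equivalence.to rest (subst (λ t → AlternatesFrom t (map tag l)) (other-tagOf b) tags))
    (λ { (weak ∷ weaks) → cong tagOf (Equivalence.to weakSign⇔ weak)
                         , subst (λ t → AlternatesFrom t (map tag l)) (sym (other-tagOf b)) (Equivalence.from rest weaks) })
    where
    weakSign⇔ = weakSign⇔≡ b (memℕ X s) sign
    rest = alternates⇒tags⇔weakSigns (not b) l alt

  feasible⇒alternating : ColumnsIndependent ν d k Y X → Feasible ν d k Y X → Alternating ν d Y X
  feasible⇒alternating indep (y , x , solution@(supported , _) , 0≤y , 0≤x) =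
    subst (AlternatesFrom tX) (sym (tagsBelow≡map-tag disjoint ν))
      (Equivalence.from (alternates⇒tags⇔weakSigns true (support ν) (basicSolution⇒alternates indep solution))
        (All.universal (weights-weakSign disjoint supported 0≤y 0≤x) (support ν)))
    where
    disjoint = independent⇒disjoint indep

  alternating⇒feasible : IsBase ν d k Y X → Alternating ν d Y X → Feasible ν d k Y X
  alternating⇒feasible (indep , span) alternating = y , x , solution , weights-weakSign⁻¹ disjoint (proj₁ solution) weakSigns
    where
    disjoint = independent⇒disjoint indep
    basic = span (λ h → rhs k (toℕ h))
    y = proj₁ basic
    x = proj₁ (proj₂ basic)
    solution = proj₂ (proj₂ basic)
    weakSigns : ∀ s → s ∈ˡ support ν → WeakSign (memℕ X s) (weights y x s)
    weakSigns s = All.lookup (Equivalence.to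
      (alternates⇒tags⇔weakSigns true (support ν) (basicSolution⇒alternates indep solution))
      (subst (AlternatesFrom tX) (tagsBelow≡map-tag disjoint ν) alternating))

open import Data.Nat using (ℕ; suc; _≤_; _<_)
import Data.Nat.Properties as ℕ
open import Data.Product using (proj₁)
open import Function.Bundles using (_⇔_; mk⇔)

proposition7 : (ν d k : ℕ) → 1 ≤ k → k ≤ d → d < ν →
               (Y : Subset ν) (X : Subset (suc d)) →
               IsBase ν d k Y X →
               (Feasible ν d k Y X ⇔ Alternating ν d Y X)
proposition7 ν d k _ k≤d d<ν Y X base = mk⇔ (feasible⇒alternating (proj₁ base)) (alternating⇒feasible base)
  where open LinearProgram ν d k (ℕ.≤-<-trans k≤d d<ν) d<ν Y X
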